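{- Let $m\ge1$ be a fixed integer. For $n\ge m$ let $\overline{a}(m,n)$ be the minimum, over all families $\mathcal{F}$ of exactly $m$ distinct subsets of $[n]$, of the number of full chains in $\mathcal{B}_n$ that contain at least one member of $\mathcal{F}$. Then, as $n\to\infty$, $$\overline{a}(m,n)\sim m\,\frac{n!}{\binom{n}{\lfloor n/2\rfloor}}.$$
   Context: $\mathcal{B}_n$ is the family of all subsets of $[n]=\{1,\dots,n\}$ ordered by inclusion. A full chain in $\mathcal{B}_n$ is a chain $\emptyset=C_0\subsetneq C_1\subsetneq\cdots\subsetneq C_n=[n]$ containing exactly one subset of each size $0,1,\dots,n$; there are $n!$ full chains. -}

module Defs where

open import Data.Bool using (Bool; true; false; _∧_; _∨_; not)
open import Data.Nat using (ℕ; zero; suc; _≡ᵇ_; _⊓_)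
open import Data.List using (List; []; _∷_; [_]; map; _++_; concatMap; filterᵇ; length; foldr)
open import Data.Bool.ListAction using (any; all)
open import Data.Vec using (Vec; []; _∷_; toList)
open import Data.Fin.Subset using (Subset; ∣_∣)

allSubsets : ∀ n → List (Subset n)
allSubsets zero = [ [] ]
allSubsets (suc n) = map (true ∷_) (allSubsets n) ++ map (false ∷_) (allSubsets n)

allVecs : ∀ {A : Set} k → List A → List (Vec A k)
allVecs zero xs = [ [] ]
allVecs (suc k) xs = concatMap (λ x → map (x ∷_) (allVecs k xs)) xs

_⊆ᵇ_ : ∀ {n} → Subset n → Subset n → Bool
[] ⊆ᵇ [] = true
(x ∷ xs) ⊆ᵇ (y ∷ ys) = (not x ∨ y) ∧ (xs ⊆ᵇ ys)

_==ᵇ_ : ∀ {n} → Subset n → Subset n → Bool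
[] ==ᵇ [] = true
(true ∷ xs) ==ᵇ (true ∷ ys) = xs ==ᵇ ys
(false ∷ xs) ==ᵇ (false ∷ ys) = xs ==ᵇ ys
(true ∷ xs) ==ᵇ (false ∷ ys) = false
(false ∷ xs) ==ᵇ (true ∷ ys) = false

sizesFrom : ∀ {n k} → ℕ → Vec (Subset n) k → Bool
sizesFrom j [] = true
sizesFrom j (x ∷ xs) = (∣ x ∣ ≡ᵇ j) ∧ sizesFrom (suc j) xs

nested : ∀ {n k} → Vec (Subset n) k → Bool
nested [] = true
nested (x ∷ []) = true
nested (x ∷ y ∷ ys) = (x ⊆ᵇ y) ∧ nested (y ∷ ys)

-- C_0 ⊆ C_1 ⊆ ... ⊆ C_n with |C_i| = i  (so C_0 = ∅, C_n = [n], strict inclusions)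
isFullChainᵇ : ∀ {n} → Vec (Subset n) (suc n) → Bool
isFullChainᵇ c = sizesFrom 0 c ∧ nested c

fullChains : ∀ n → List (Vec (Subset n) (suc n))
fullChains n = filterᵇ isFullChainᵇ (allVecs (suc n) (allSubsets n))

hitsᵇ : ∀ {n} → List (Subset n) → Vec (Subset n) (suc n) → Bool
hitsᵇ F c = any (λ S → any (λ C → S ==ᵇ C) (toList c)) F

chainsHitting : ∀ n → List (Subset n) → ℕ
chainsHitting n F = length (filterᵇ (hitsᵇ F) (fullChains n))

distinctᵇ : ∀ {n} → List (Subset n) → Bool
distinctᵇ [] = true
distinctᵇ (x ∷ xs) = all (λ y → not (x ==ᵇ y)) xs ∧ distinctᵇ xs

-- families of exactly m distinct subsets of [n] (listed in every order; order is irrelevant)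
families : ∀ m n → List (List (Subset n))
families m n = filterᵇ distinctᵇ (map toList (allVecs m (allSubsets n)))

minList : List ℕ → ℕ
minList [] = 0
minList (x ∷ xs) = foldr _⊓_ x xs

-- ā(m,n): minimum over families F of m distinct subsets of the number of full chains hitting F
-- (the family list is nonempty whenever n ≥ m)
abar : ℕ → ℕ → ℕ
abar m n = minList (map (chainsHitting n) (families m n))

module Submission where

-- Write C = n C ⌊ n /2⌋. A set S lies on ∣ S ∣ ! (n ∸ ∣ S ∣) ! = n ! / (n C ∣ S ∣) ≥ n ! / C full chains.
-- Upper bound: m distinct sets of size ⌊ n /2⌋ are hit by at most m · n ! / C chains (union bound).
-- Lower bound: if some member S of the family has m · (n C ∣ S ∣) ≤ C, then S alone lies on at least
-- m · n ! / C chains. Otherwise every member has 0 < ∣ S ∣ < n, and by the Bonferroni inequality the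
-- chains hitting the family number at least m · n ! / C minus the chains through two members. Chains
-- through S ⊂ T with ∣ S ∣ = a < b = ∣ T ∣ number a ! (b ∸ a) ! (n ∸ b) !, which is at most
-- 2 m · n ! / ((n + 1) C). So the m² pairs cost at most a fraction 2 m² / (n + 1) of m · n ! / C,
-- which is at most 1 / k once n + 1 ≥ 2 k m².

open import Data.Bool using (Bool; true; false; _∧_; _∨_; not; if_then_else_; T?)
open import Data.Bool.ListAction using (any; all)
open import Data.Bool.Properties using (∧-zeroʳ; ∧-identityʳ; ∨-zeroʳ; ∧-assoc; ∧-comm; ∧-distribˡ-∨; T-≡; T-not-≡)
open import Data.Fin.Subset using (Subset; ⊥; ⊤; ∣_∣)
open import Data.Fin.Subset.Properties using (∣p∣≤n; ∣⊥∣≡0; ∣⊤∣≡n)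
open import Data.List using (List; []; _∷_; [_]; map; _++_; concatMap; filterᵇ; length; foldr)
open import Data.List.Membership.Propositional using (_∈_; lose; find)
open import Data.List.Membership.Propositional.Properties
  using (∈-++⁺ˡ; ∈-++⁺ʳ; ∈-map⁺; ∈-map⁻; ∈-concatMap⁺; ∈-filter⁺; ∈-filter⁻; foldr-selective)
open import Data.List.Properties using (map-cong)
open import Data.List.Relation.Unary.All using (All; []; _∷_; all?)
open import Data.List.Relation.Unary.All.Properties using (¬All⇒Any¬)
open import Data.List.Relation.Unary.Any using (here; there)
open import Data.Nat
open import Data.Nat.Combinatorics using (_C_; nCk≡nC[n∸k]; nCk+nC[k+1]≡[n+1]C[k+1]; nCn≡1; nC1≡n; k![n∸k]!∣n!)
open import Data.Nat.Combinatorics.Specification using (nCk≡n!/k![n-k]!)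
open import Data.Nat.DivMod using (m/n*n≡m)
open import Data.Nat.ListAction using (sum)
open import Data.Nat.Properties
open import Data.Nat.Tactic.RingSolver using (solve-∀)
open import Data.Product using (_×_; _,_; ∃-syntax)
open import Data.Sum using (inj₁; inj₂)
open import Data.Vec using (Vec; []; _∷_; toList)
open import Data.Vec.Properties using (length-toList)
open import Function using (_∘_)
open import Function.Bundles using (Equivalence)
open import Relation.Binary.PropositionalEquality hiding ([_])
open import Relation.Nullary using (yes; no; contradiction)

open import Defs

private variable n : ℕ

-- Binomial coefficients

nCk*k!*[n∸k]!≡n! : ∀ {n k} → k ≤ n → (n C k) * (k ! * (n ∸ k) !) ≡ n !
nCk*k!*[n∸k]!≡n! {n} {k} k≤n =
  trans (cong (_* (k ! * (n ∸ k) !)) (nCk≡n!/k![n-k]! k≤n)) (m/n*n≡m (k![n∸k]!∣n! k≤n))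
  where instance _ = k !* (n ∸ k) !≢0

binom : ℕ → ℕ → ℕ
binom k l = (k + l) C k

binom*k!*l!≡[k+l]! : ∀ k l → binom k l * (k ! * l !) ≡ (k + l) !
binom*k!*l!≡[k+l]! k l =
  subst (λ t → binom k l * (k ! * t !) ≡ (k + l) !) (m+n∸m≡n k l) (nCk*k!*[n∸k]!≡n! (m≤m+n k l))

binom-comm : ∀ k l → binom k l ≡ binom l k
binom-comm k l = begin
  (k + l) C k            ≡⟨ nCk≡nC[n∸k] (m≤m+n k l) ⟩
  (k + l) C (k + l ∸ k)  ≡⟨ cong ((k + l) C_) (m+n∸m≡n k l) ⟩
  (k + l) C l            ≡⟨ cong (_C l) (+-comm k l) ⟩
  (l + k) C l            ∎
  where open ≡-Reasoning

binom-pos : ∀ k l → 0 < binom k l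
binom-pos k l = n≢0⇒n>0 λ b≡0 →
  <⇒≢ (1≤n! (k + l)) (sym (trans (sym (binom*k!*l!≡[k+l]! k l)) (cong (_* (k ! * l !)) b≡0)))

binom-pascal : ∀ k l → binom (suc k) (suc l) ≡ binom k (suc l) + binom (suc k) l
binom-pascal k l = trans (sym (nCk+nC[k+1]≡[n+1]C[k+1] (k + suc l) k))
  (cong (λ t → (k + suc l) C k + t C suc k) (+-suc k l))

binom-ratio : ∀ k l → binom k (suc l) * suc l ≡ binom (suc k) l * suc k
binom-ratio k l = *-cancelʳ-≡ _ _ (k ! * l !) {{k !* l !≢0}} (begin
  binom k (suc l) * suc l * (k ! * l !)        ≡⟨ regroupˡ (binom k (suc l)) (suc l) (k !) (l !) ⟩
  binom k (suc l) * (k ! * (suc l * l !))      ≡⟨ binom*k!*l!≡[k+l]! k (suc l) ⟩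
  (k + suc l) !                                ≡⟨ cong _! (+-suc k l) ⟩
  (suc k + l) !                                ≡⟨ binom*k!*l!≡[k+l]! (suc k) l ⟨
  binom (suc k) l * ((suc k * k !) * l !)      ≡⟨ regroupʳ (binom (suc k) l) (suc k) (k !) (l !) ⟩
  binom (suc k) l * suc k * (k ! * l !)        ∎)
  where
  open ≡-Reasoning
  regroupˡ : ∀ a b x y → a * b * (x * y) ≡ a * (x * (b * y))
  regroupˡ = solve-∀
  regroupʳ : ∀ a b x y → a * ((b * x) * y) ≡ a * b * (x * y)
  regroupʳ = solve-∀

binom-≤-step : ∀ k l → k ≤ l → binom k (suc l) ≤ binom (suc k) l
binom-≤-step k l k≤l = *-cancelʳ-≤ _ _ (suc k) (begin
  binom k (suc l) * suc k   ≤⟨ *-monoʳ-≤ (binom k (suc l)) (s≤s k≤l) ⟩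
  binom k (suc l) * suc l   ≡⟨ binom-ratio k l ⟩
  binom (suc k) l * suc k   ∎)
  where open ≤-Reasoning

binom-≤-shift : ∀ j k l → k + j ≤ suc l → binom k (j + l) ≤ binom (k + j) l
binom-≤-shift zero k l _ = ≤-reflexive (cong (λ t → binom t l) (sym (+-identityʳ k)))
binom-≤-shift (suc j) k l k+j<l = begin
  binom k (suc (j + l))   ≤⟨ binom-≤-step k (j + l) k≤j+l ⟩
  binom (suc k) (j + l)   ≤⟨ binom-≤-shift j (suc k) l sk+j≤l ⟩
  binom (suc k + j) l     ≡⟨ cong (λ t → binom t l) (+-suc k j) ⟨
  binom (k + suc j) l     ∎
  where
  open ≤-Reasoning
  sk+j≤l : suc k + j ≤ suc l
  sk+j≤l = subst (_≤ suc l) (+-suc k j) k+j<l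
  k≤j+l : k ≤ j + l
  k≤j+l = ≤-trans (m≤m+n k j) (≤-trans (≤-pred sk+j≤l) (m≤n+m l j))

binom-≤-balancedˡ : ∀ {k l h h'} → h ≤ suc h' → k ≤ h → k + l ≡ h + h' → binom k l ≤ binom h h'
binom-≤-balancedˡ {k} {l} {h} {h'} h≤1+h' k≤h eq =
  subst₂ (λ a b → binom k a ≤ binom b h') [h∸k]+h'≡l k+[h∸k]≡h
    (binom-≤-shift (h ∸ k) k h' (subst (_≤ suc h') (sym k+[h∸k]≡h) h≤1+h'))
  where
  k+[h∸k]≡h : k + (h ∸ k) ≡ h
  k+[h∸k]≡h = m+[n∸m]≡n k≤h
  [h∸k]+h'≡l : (h ∸ k) + h' ≡ l
  [h∸k]+h'≡l = +-cancelˡ-≡ k _ _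
    (trans (sym (+-assoc k (h ∸ k) h')) (trans (cong (_+ h') k+[h∸k]≡h) (sym eq)))

binom-≤-balanced : ∀ {k l h h'} → h ≤ h' → h' ≤ suc h → k + l ≡ h + h' → binom k l ≤ binom h h'
binom-≤-balanced {k} {l} {h} {h'} h≤h' h'≤1+h eq with k ≤? h
... | yes k≤h = binom-≤-balancedˡ (m≤n⇒m≤1+n h≤h') k≤h eq
... | no k≰h = subst (_≤ binom h h') (binom-comm l k)
  (binom-≤-balancedˡ (m≤n⇒m≤1+n h≤h') l≤h (trans (+-comm l k) eq))
  where
  open ≤-Reasoning
  l≤h : l ≤ h
  l≤h = +-cancelˡ-≤ (suc h) l h (begin
    suc h + l   ≤⟨ +-monoˡ-≤ l (≰⇒> k≰h) ⟩
    k + l       ≡⟨ eq ⟩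
    h + h'      ≤⟨ +-monoʳ-≤ h h'≤1+h ⟩
    h + suc h   ≡⟨ +-comm h (suc h) ⟩
    suc h + h   ∎)

nCk≡binom : ∀ {n k} → k ≤ n → n C k ≡ binom k (n ∸ k)
nCk≡binom {k = k} k≤n = cong (_C k) (sym (m+[n∸m]≡n k≤n))

nC⌊n/2⌋≡binom : ∀ n → n C ⌊ n /2⌋ ≡ binom ⌊ n /2⌋ ⌈ n /2⌉
nC⌊n/2⌋≡binom n = cong (_C ⌊ n /2⌋) (sym (⌊n/2⌋+⌈n/2⌉≡n n))

nCk≤nC⌊n/2⌋ : ∀ {n k} → k ≤ n → n C k ≤ n C ⌊ n /2⌋
nCk≤nC⌊n/2⌋ {n} {k} k≤n = subst₂ _≤_ (sym (nCk≡binom k≤n)) (sym (nC⌊n/2⌋≡binom n))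
  (binom-≤-balanced {k} {n ∸ k} (⌊n/2⌋≤⌈n/2⌉ n) (⌊n/2⌋-mono (n≤1+n (suc n)))
    (trans (m+[n∸m]≡n k≤n) (sym (⌊n/2⌋+⌈n/2⌉≡n n))))

binom-≥-sum : ∀ k l → suc k + suc l ≤ binom (suc k) (suc l)
binom-≥-sum zero l = ≤-reflexive (sym (nC1≡n (suc (suc l))))
binom-≥-sum (suc k) l = begin
  suc (suc k + suc l)                             ≡⟨ +-comm 1 (suc k + suc l) ⟩
  suc k + suc l + 1                               ≤⟨ +-mono-≤ (binom-≥-sum k l) (binom-pos (suc (suc k)) l) ⟩
  binom (suc k) (suc l) + binom (suc (suc k)) l   ≡⟨ binom-pascal (suc k) l ⟨
  binom (suc (suc k)) (suc l)                     ∎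
  where open ≤-Reasoning

n≤nC⌊n/2⌋ : ∀ {n} → 2 ≤ n → n ≤ n C ⌊ n /2⌋
n≤nC⌊n/2⌋ {n} 2≤n with ⌊ n /2⌋ | ⌈ n /2⌉ | ⌊n/2⌋+⌈n/2⌉≡n n | nC⌊n/2⌋≡binom n | ⌊n/2⌋-mono 2≤n | ⌈n/2⌉-mono 2≤n
... | suc h | suc h' | h+h'≡n | C≡binom | _ | _ =
  subst₂ _≤_ h+h'≡n (sym C≡binom) (binom-≥-sum h h')

[k+l]*k!*l!≤[k+l]! : ∀ {k l} → 1 ≤ k → 1 ≤ l → (k + l) * (k ! * l !) ≤ (k + l) !
[k+l]*k!*l!≤[k+l]! {suc k} {suc l} _ _ =
  ≤-trans (*-monoˡ-≤ _ (binom-≥-sum k l)) (≤-reflexive (binom*k!*l!≡[k+l]! (suc k) (suc l)))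

p!q!r!c[p+q]≤m[p+q+r]! : ∀ {p q r m c} → 1 ≤ p → 1 ≤ q → c ≤ m * binom (p + q) r →
                         p ! * q ! * r ! * c * (p + q) ≤ m * (p + q + r) !
p!q!r!c[p+q]≤m[p+q+r]! {p} {q} {r} {m} {c} 1≤p 1≤q c≤ = begin
  p ! * q ! * r ! * c * (p + q)              ≡⟨ regroup (p !) (q !) (r !) c (p + q) ⟩
  c * ((p + q) * (p ! * q !)) * r !          ≤⟨ *-monoˡ-≤ (r !) (*-mono-≤ c≤ ([k+l]*k!*l!≤[k+l]! 1≤p 1≤q)) ⟩
  m * binom (p + q) r * (p + q) ! * r !      ≡⟨ regroup′ m (binom (p + q) r) ((p + q) !) (r !) ⟩
  m * (binom (p + q) r * ((p + q) ! * r !))  ≡⟨ cong (m *_) (binom*k!*l!≡[k+l]! (p + q) r) ⟩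
  m * (p + q + r) !                          ∎
  where
  open ≤-Reasoning
  regroup : ∀ x y z c s → x * y * z * c * s ≡ c * (s * (x * y)) * z
  regroup = solve-∀
  regroup′ : ∀ m a b d → m * a * b * d ≡ m * (a * (b * d))
  regroup′ = solve-∀

-- p + q + r + 1 ≤ (p + q) + (q + r), and each part is bounded by the previous lemma.
p!q!r!c[1+p+q+r]≤2m[p+q+r]! : ∀ {p q r m c} → 1 ≤ p → 1 ≤ q → 1 ≤ r →
  c ≤ m * binom (p + q) r → c ≤ m * binom p (q + r) →
  p ! * q ! * r ! * c * suc (p + q + r) ≤ 2 * m * (p + q + r) !
p!q!r!c[1+p+q+r]≤2m[p+q+r]! {p} {q} {r} {m} {c} 1≤p 1≤q 1≤r c≤ c≤′ = begin
  Z * suc (p + q + r)                      ≤⟨ *-monoʳ-≤ Z 1+p+q+r≤ ⟩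
  Z * ((p + q) + (q + r))                  ≡⟨ *-distribˡ-+ Z (p + q) (q + r) ⟩
  Z * (p + q) + Z * (q + r)                ≤⟨ +-mono-≤ (p!q!r!c[p+q]≤m[p+q+r]! {r = r} {m} 1≤p 1≤q c≤) rightHalf ⟩
  m * (p + q + r) ! + m * (p + q + r) !    ≡⟨ double m ((p + q + r) !) ⟩
  2 * m * (p + q + r) !                    ∎
  where
  open ≤-Reasoning
  Z : ℕ
  Z = p ! * q ! * r ! * c
  double : ∀ m x → m * x + m * x ≡ 2 * m * x
  double = solve-∀
  1+p+q+r≤ : suc (p + q + r) ≤ (p + q) + (q + r)
  1+p+q+r≤ = subst₂ _≤_ (+-comm (p + q + r) 1) (regroup p q r) (+-monoʳ-≤ (p + q + r) 1≤q)
    where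
    regroup : ∀ p q r → p + q + r + q ≡ (p + q) + (q + r)
    regroup = solve-∀
  rightHalf : Z * (q + r) ≤ m * (p + q + r) !
  rightHalf = subst₂ _≤_ (rotate (p !) (q !) (r !) c (q + r)) (cong (λ t → m * t !) (rotate⁺ q r p))
    (p!q!r!c[p+q]≤m[p+q+r]! {r = p} {m} 1≤q 1≤r (subst (λ t → c ≤ m * t) (binom-comm p (q + r)) c≤′))
    where
    rotate : ∀ x y z c s → y * z * x * c * s ≡ x * y * z * c * s
    rotate = solve-∀
    rotate⁺ : ∀ q r p → q + r + p ≡ p + q + r
    rotate⁺ = solve-∀

-- Counting with Boolean predicates

private
  ∧≡true⇒ : ∀ a b → (a ∧ b) ≡ true → (a ≡ true) × (b ≡ true)
  ∧≡true⇒ true true _ = refl , refl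

  ∧-zeroʳ₂ : ∀ a b → (a ∧ (b ∧ false)) ≡ false
  ∧-zeroʳ₂ a b = trans (cong (a ∧_) (∧-zeroʳ b)) (∧-zeroʳ a)

countᵇ : ∀ {A : Set} → (A → Bool) → List A → ℕ
countᵇ p [] = 0
countᵇ p (x ∷ xs) = if p x then suc (countᵇ p xs) else countᵇ p xs

module _ {A : Set} where

  length-filterᵇ : ∀ (p : A → Bool) xs → length (filterᵇ p xs) ≡ countᵇ p xs
  length-filterᵇ p [] = refl
  length-filterᵇ p (x ∷ xs) with p x
  ... | true = cong suc (length-filterᵇ p xs)
  ... | false = length-filterᵇ p xs

  countᵇ-cong : ∀ {p q : A → Bool} → (∀ x → p x ≡ q x) → ∀ xs → countᵇ p xs ≡ countᵇ q xs
  countᵇ-cong p≗q [] = refl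
  countᵇ-cong {p} {q} p≗q (x ∷ xs) rewrite p≗q x with q x
  ... | true = cong suc (countᵇ-cong p≗q xs)
  ... | false = countᵇ-cong p≗q xs

  countᵇ-mono : ∀ {p q : A → Bool} → (∀ x → p x ≡ true → q x ≡ true) → ∀ xs → countᵇ p xs ≤ countᵇ q xs
  countᵇ-mono p⇒q [] = z≤n
  countᵇ-mono {p} {q} p⇒q (x ∷ xs) with p x in px
  ... | true rewrite p⇒q x px = s≤s (countᵇ-mono p⇒q xs)
  ... | false with q x
  ...   | true = m≤n⇒m≤1+n (countᵇ-mono p⇒q xs)
  ...   | false = countᵇ-mono p⇒q xs

  countᵇ-false : ∀ {p : A → Bool} → (∀ x → p x ≡ false) → ∀ xs → countᵇ p xs ≡ 0
  countᵇ-false p≡false [] = refl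
  countᵇ-false p≡false (x ∷ xs) rewrite p≡false x = countᵇ-false p≡false xs

  countᵇ-filterᵇ : ∀ (p q : A → Bool) xs → countᵇ q (filterᵇ p xs) ≡ countᵇ (λ x → p x ∧ q x) xs
  countᵇ-filterᵇ p q [] = refl
  countᵇ-filterᵇ p q (x ∷ xs) with p x
  ... | false = countᵇ-filterᵇ p q xs
  ... | true with q x
  ...   | true = cong suc (countᵇ-filterᵇ p q xs)
  ...   | false = countᵇ-filterᵇ p q xs

  countᵇ-++ : ∀ (p : A → Bool) xs ys → countᵇ p (xs ++ ys) ≡ countᵇ p xs + countᵇ p ys
  countᵇ-++ p [] ys = refl
  countᵇ-++ p (x ∷ xs) ys with p x
  ... | true = cong suc (countᵇ-++ p xs ys)
  ... | false = countᵇ-++ p xs ys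

  countᵇ-∨+countᵇ-∧ : ∀ (p q : A → Bool) xs →
    countᵇ (λ x → p x ∨ q x) xs + countᵇ (λ x → p x ∧ q x) xs ≡ countᵇ p xs + countᵇ q xs
  countᵇ-∨+countᵇ-∧ p q [] = refl
  countᵇ-∨+countᵇ-∧ p q (x ∷ xs) with p x | q x
  ... | true | true = cong suc (trans (+-suc _ _)
    (trans (cong suc (countᵇ-∨+countᵇ-∧ p q xs)) (sym (+-suc (countᵇ p xs) (countᵇ q xs)))))
  ... | true | false = cong suc (countᵇ-∨+countᵇ-∧ p q xs)
  ... | false | true = trans (cong suc (countᵇ-∨+countᵇ-∧ p q xs)) (sym (+-suc (countᵇ p xs) (countᵇ q xs)))
  ... | false | false = countᵇ-∨+countᵇ-∧ p q xs

  countᵇ-∨ : ∀ (p q : A → Bool) xs → countᵇ (λ x → p x ∨ q x) xs ≤ countᵇ p xs + countᵇ q xs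
  countᵇ-∨ p q xs = subst (countᵇ (λ x → p x ∨ q x) xs ≤_) (countᵇ-∨+countᵇ-∧ p q xs) (m≤m+n _ _)

  sum-map-if : ∀ (p : A → Bool) c xs → sum (map (λ x → if p x then c else 0) xs) ≡ countᵇ p xs * c
  sum-map-if p c [] = refl
  sum-map-if p c (x ∷ xs) with p x
  ... | true = cong (c +_) (sum-map-if p c xs)
  ... | false = sum-map-if p c xs

  sum-map-guarded : ∀ (g : A → ℕ) (p : A → Bool) c → (∀ x → g x ≡ (if p x then c else 0)) →
                    ∀ xs → sum (map g xs) ≡ countᵇ p xs * c
  sum-map-guarded g p c g≗ xs = trans (cong sum (map-cong g≗ xs)) (sum-map-if p c xs)

module _ {A B : Set} where

  countᵇ-map : ∀ (p : B → Bool) (f : A → B) xs → countᵇ p (map f xs) ≡ countᵇ (p ∘ f) xs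
  countᵇ-map p f [] = refl
  countᵇ-map p f (x ∷ xs) with p (f x)
  ... | true = cong suc (countᵇ-map p f xs)
  ... | false = countᵇ-map p f xs

  countᵇ-concatMap : ∀ (p : B → Bool) (f : A → List B) xs →
                     countᵇ p (concatMap f xs) ≡ sum (map (countᵇ p ∘ f) xs)
  countᵇ-concatMap p f [] = refl
  countᵇ-concatMap p f (x ∷ xs) =
    trans (countᵇ-++ p (f x) (concatMap f xs)) (cong (countᵇ p (f x) +_) (countᵇ-concatMap p f xs))

countᵇ-allVecs-suc : ∀ {A : Set} (L : List A) k (p : Vec A (suc k) → Bool) →
  countᵇ p (allVecs (suc k) L) ≡ sum (map (λ x → countᵇ (p ∘ (x ∷_)) (allVecs k L)) L)
countᵇ-allVecs-suc L k p = trans (countᵇ-concatMap p (λ x → map (x ∷_) (allVecs k L)) L)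
  (cong sum (map-cong (λ x → countᵇ-map p (x ∷_) (allVecs k L)) L))

-- Subsets as bit vectors

≡ᵇ-true⇒≡ : ∀ {m n} → (m ≡ᵇ n) ≡ true → m ≡ n
≡ᵇ-true⇒≡ {m} {n} e = ≡ᵇ⇒≡ m n (Equivalence.from T-≡ e)

≢⇒≡ᵇ-false : ∀ {m n} → m ≢ n → (m ≡ᵇ n) ≡ false
≢⇒≡ᵇ-false {m} {n} m≢n with m ≡ᵇ n in e
... | true = contradiction (≡ᵇ-true⇒≡ e) m≢n
... | false = refl

==ᵇ⇒≡ : ∀ (X Y : Subset n) → (X ==ᵇ Y) ≡ true → X ≡ Y
==ᵇ⇒≡ [] [] _ = refl
==ᵇ⇒≡ (true ∷ X) (true ∷ Y) e = cong (true ∷_) (==ᵇ⇒≡ X Y e)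
==ᵇ⇒≡ (false ∷ X) (false ∷ Y) e = cong (false ∷_) (==ᵇ⇒≡ X Y e)

==ᵇ-refl : ∀ (X : Subset n) → (X ==ᵇ X) ≡ true
==ᵇ-refl [] = refl
==ᵇ-refl (true ∷ X) = ==ᵇ-refl X
==ᵇ-refl (false ∷ X) = ==ᵇ-refl X

==ᵇ-sym : ∀ (X Y : Subset n) → (X ==ᵇ Y) ≡ (Y ==ᵇ X)
==ᵇ-sym [] [] = refl
==ᵇ-sym (true ∷ X) (true ∷ Y) = ==ᵇ-sym X Y
==ᵇ-sym (false ∷ X) (false ∷ Y) = ==ᵇ-sym X Y
==ᵇ-sym (true ∷ X) (false ∷ Y) = refl
==ᵇ-sym (false ∷ X) (true ∷ Y) = refl

⊆ᵇ-refl : ∀ (X : Subset n) → (X ⊆ᵇ X) ≡ true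
⊆ᵇ-refl [] = refl
⊆ᵇ-refl (true ∷ X) = ⊆ᵇ-refl X
⊆ᵇ-refl (false ∷ X) = ⊆ᵇ-refl X

⊥⊆ᵇ : ∀ (X : Subset n) → (⊥ ⊆ᵇ X) ≡ true
⊥⊆ᵇ [] = refl
⊥⊆ᵇ (x ∷ X) = ⊥⊆ᵇ X

⊆ᵇ⊤ : ∀ (X : Subset n) → (X ⊆ᵇ ⊤) ≡ true
⊆ᵇ⊤ [] = refl
⊆ᵇ⊤ (true ∷ X) = ⊆ᵇ⊤ X
⊆ᵇ⊤ (false ∷ X) = ⊆ᵇ⊤ X

⊆ᵇ⇒∣∣≤ : ∀ (X Y : Subset n) → (X ⊆ᵇ Y) ≡ true → ∣ X ∣ ≤ ∣ Y ∣
⊆ᵇ⇒∣∣≤ [] [] _ = z≤n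
⊆ᵇ⇒∣∣≤ (true ∷ X) (true ∷ Y) e = s≤s (⊆ᵇ⇒∣∣≤ X Y e)
⊆ᵇ⇒∣∣≤ (false ∷ X) (true ∷ Y) e = m≤n⇒m≤1+n (⊆ᵇ⇒∣∣≤ X Y e)
⊆ᵇ⇒∣∣≤ (false ∷ X) (false ∷ Y) e = ⊆ᵇ⇒∣∣≤ X Y e

⊆ᵇ∧∣∣≥⇒≡ : ∀ (X Y : Subset n) → (X ⊆ᵇ Y) ≡ true → ∣ Y ∣ ≤ ∣ X ∣ → X ≡ Y
⊆ᵇ∧∣∣≥⇒≡ [] [] _ _ = refl
⊆ᵇ∧∣∣≥⇒≡ (true ∷ X) (true ∷ Y) e le = cong (true ∷_) (⊆ᵇ∧∣∣≥⇒≡ X Y e (≤-pred le))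
⊆ᵇ∧∣∣≥⇒≡ (false ∷ X) (false ∷ Y) e le = cong (false ∷_) (⊆ᵇ∧∣∣≥⇒≡ X Y e le)
⊆ᵇ∧∣∣≥⇒≡ (false ∷ X) (true ∷ Y) e le = contradiction le (<⇒≱ (s≤s (⊆ᵇ⇒∣∣≤ X Y e)))

⊂ᵇ⇒∣∣< : ∀ (X Y : Subset n) → (X ⊆ᵇ Y) ≡ true → (X ==ᵇ Y) ≡ false → ∣ X ∣ < ∣ Y ∣
⊂ᵇ⇒∣∣< X Y X⊆Y X≠Y with ∣ X ∣ <? ∣ Y ∣
... | yes lt = lt
... | no ≮ with ⊆ᵇ∧∣∣≥⇒≡ X Y X⊆Y (≮⇒≥ ≮)
...   | refl = contradiction (trans (sym X≠Y) (==ᵇ-refl X)) λ ()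

∣∣≡ᵇ0≡==ᵇ⊥ : ∀ (X : Subset n) → (∣ X ∣ ≡ᵇ 0) ≡ (X ==ᵇ ⊥)
∣∣≡ᵇ0≡==ᵇ⊥ [] = refl
∣∣≡ᵇ0≡==ᵇ⊥ (true ∷ X) = refl
∣∣≡ᵇ0≡==ᵇ⊥ (false ∷ X) = ∣∣≡ᵇ0≡==ᵇ⊥ X

∣∣>0⇒≠ᵇ⊥ : ∀ (X : Subset n) → 0 < ∣ X ∣ → (X ==ᵇ ⊥) ≡ false
∣∣>0⇒≠ᵇ⊥ X 0<∣X∣ = trans (sym (∣∣≡ᵇ0≡==ᵇ⊥ X)) (≢⇒≡ᵇ-false (>⇒≢ 0<∣X∣))

countᵇ-allSubsets-suc : ∀ n (p : Subset (suc n) → Bool) → countᵇ p (allSubsets (suc n)) ≡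
  countᵇ (p ∘ (true ∷_)) (allSubsets n) + countᵇ (p ∘ (false ∷_)) (allSubsets n)
countᵇ-allSubsets-suc n p = trans (countᵇ-++ p (map (true ∷_) (allSubsets n)) _)
  (cong₂ _+_ (countᵇ-map p (true ∷_) (allSubsets n)) (countᵇ-map p (false ∷_) (allSubsets n)))

countᵇ-==ᵇ : ∀ (W : Subset n) → countᵇ (_==ᵇ W) (allSubsets n) ≡ 1
countᵇ-==ᵇ [] = refl
countᵇ-==ᵇ {suc n} (true ∷ W) = trans (countᵇ-allSubsets-suc n (_==ᵇ (true ∷ W)))
  (cong₂ _+_ (countᵇ-==ᵇ W) (countᵇ-false (λ _ → refl) (allSubsets n)))
countᵇ-==ᵇ {suc n} (false ∷ W) = trans (countᵇ-allSubsets-suc n (_==ᵇ (false ∷ W)))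
  (cong₂ _+_ (countᵇ-false (λ _ → refl) (allSubsets n)) (countᵇ-==ᵇ W))

betweenᵇ : Subset n → ℕ → Subset n → Subset n → Bool
betweenᵇ X j Y Z = (X ⊆ᵇ Z) ∧ ((∣ Z ∣ ≡ᵇ j) ∧ (Z ⊆ᵇ Y))

count-between-∣X∣ : ∀ (X Y : Subset n) → countᵇ (betweenᵇ X ∣ X ∣ Y) (allSubsets n) ≡ (if X ⊆ᵇ Y then 1 else 0)
count-between-∣X∣ [] [] = refl
count-between-∣X∣ {suc n} (false ∷ X) (true ∷ Y) = trans (countᵇ-allSubsets-suc n _)
  (cong₂ _+_ (countᵇ-false none (allSubsets n)) (count-between-∣X∣ X Y))
  where
  none : ∀ Z → ((X ⊆ᵇ Z) ∧ ((suc ∣ Z ∣ ≡ᵇ ∣ X ∣) ∧ (Z ⊆ᵇ Y))) ≡ false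
  none Z with X ⊆ᵇ Z in X⊆Z
  ... | false = refl
  ... | true rewrite ≢⇒≡ᵇ-false (>⇒≢ (s≤s (⊆ᵇ⇒∣∣≤ X Z X⊆Z))) = refl
count-between-∣X∣ {suc n} (false ∷ X) (false ∷ Y) = trans (countᵇ-allSubsets-suc n _)
  (cong₂ _+_ (countᵇ-false (λ Z → ∧-zeroʳ₂ (X ⊆ᵇ Z) _) (allSubsets n)) (count-between-∣X∣ X Y))
count-between-∣X∣ {suc n} (true ∷ X) (true ∷ Y) = trans (countᵇ-allSubsets-suc n _)
  (trans (cong₂ _+_ (count-between-∣X∣ X Y) (countᵇ-false (λ _ → refl) (allSubsets n))) (+-identityʳ _))
count-between-∣X∣ {suc n} (true ∷ X) (false ∷ Y) = trans (countᵇ-allSubsets-suc n _)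
  (cong₂ _+_ (countᵇ-false (λ Z → ∧-zeroʳ₂ (X ⊆ᵇ Z) _) (allSubsets n)) (countᵇ-false (λ _ → refl) (allSubsets n)))

count-between-1+∣X∣ : ∀ (X Y : Subset n) →
  countᵇ (betweenᵇ X (suc ∣ X ∣) Y) (allSubsets n) ≡ (if X ⊆ᵇ Y then ∣ Y ∣ ∸ ∣ X ∣ else 0)
count-between-1+∣X∣ [] [] = refl
count-between-1+∣X∣ {suc n} (false ∷ X) (true ∷ Y) = trans (countᵇ-allSubsets-suc n _)
  (trans (cong₂ _+_ (count-between-∣X∣ X Y) (count-between-1+∣X∣ X Y)) (add-new (X ⊆ᵇ Y) refl))
  where
  add-new : ∀ b → (X ⊆ᵇ Y) ≡ b →
            (if b then 1 else 0) + (if b then ∣ Y ∣ ∸ ∣ X ∣ else 0) ≡ (if b then suc ∣ Y ∣ ∸ ∣ X ∣ else 0)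
  add-new true X⊆Y = sym (+-∸-assoc 1 (⊆ᵇ⇒∣∣≤ X Y X⊆Y))
  add-new false _ = refl
count-between-1+∣X∣ {suc n} (false ∷ X) (false ∷ Y) = trans (countᵇ-allSubsets-suc n _)
  (cong₂ _+_ (countᵇ-false (λ Z → ∧-zeroʳ₂ (X ⊆ᵇ Z) _) (allSubsets n)) (count-between-1+∣X∣ X Y))
count-between-1+∣X∣ {suc n} (true ∷ X) (true ∷ Y) = trans (countᵇ-allSubsets-suc n _)
  (trans (cong₂ _+_ (count-between-1+∣X∣ X Y) (countᵇ-false (λ _ → refl) (allSubsets n))) (+-identityʳ _))
count-between-1+∣X∣ {suc n} (true ∷ X) (false ∷ Y) = trans (countᵇ-allSubsets-suc n _)
  (cong₂ _+_ (countᵇ-false (λ Z → ∧-zeroʳ₂ (X ⊆ᵇ Z) _) (allSubsets n)) (countᵇ-false (λ _ → refl) (allSubsets n)))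

-- Counting saturated chains

falling : ℕ → ℕ → ℕ
falling d zero = 1
falling d (suc k) = d * falling (pred d) k

falling-n-n≡n! : ∀ d → falling d d ≡ d !
falling-n-n≡n! zero = refl
falling-n-n≡n! (suc d) = cong (suc d *_) (falling-n-n≡n! d)

falling≤! : ∀ d k → falling d k ≤ d !
falling≤! zero zero = ≤-refl
falling≤! zero (suc k) = z≤n
falling≤! (suc d) zero = 1≤n! (suc d)
falling≤! (suc d) (suc k) = *-monoʳ-≤ (suc d) (falling≤! d k)

-- climbThen c g k = g ! * c (k ∸ g) if g ≤ k, and 0 otherwise: the number of ways to climb
-- a gap of g in k steps and spend the remaining steps in one of c (k ∸ g) ways.
climbThen : (ℕ → ℕ) → ℕ → ℕ → ℕ
climbThen c zero k = c k
climbThen c (suc g) zero = 0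
climbThen c (suc g) (suc k) = suc g * climbThen c g k

climbThen-+ : ∀ c g r → climbThen c g (g + r) ≡ g ! * c r
climbThen-+ c zero r = sym (+-identityʳ (c r))
climbThen-+ c (suc g) r = trans (cong (suc g *_) (climbThen-+ c g r)) (sym (*-assoc (suc g) (g !) (c r)))

climbThen-≤ : ∀ c B → (∀ r → c r ≤ B) → ∀ g k → climbThen c g k ≤ g ! * B
climbThen-≤ c B c≤B zero k = subst (c k ≤_) (sym (+-identityʳ B)) (c≤B k)
climbThen-≤ c B c≤B (suc g) zero = z≤n
climbThen-≤ c B c≤B (suc g) (suc k) = subst (suc g * climbThen c g k ≤_) (sym (*-assoc (suc g) (g !) B))
  (*-monoʳ-≤ (suc g) (climbThen-≤ c B c≤B g k))

countSeqs : ∀ n k → (Vec (Subset n) k → Bool) → ℕ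
countSeqs n k p = countᵇ p (allVecs k (allSubsets n))

countSeqs-cong : ∀ n k {p q : Vec (Subset n) k → Bool} → (∀ v → p v ≡ q v) → countSeqs n k p ≡ countSeqs n k q
countSeqs-cong n k p≗q = countᵇ-cong p≗q (allVecs k (allSubsets n))

countSeqs-suc : ∀ n k (p : Vec (Subset n) (suc k) → Bool) →
  countSeqs n (suc k) p ≡ sum (map (λ Z → countSeqs n k (p ∘ (Z ∷_))) (allSubsets n))
countSeqs-suc n k p = countᵇ-allVecs-suc (allSubsets n) k p

ascentᵇ : ∀ {k} → Subset n → Subset n → ℕ → Vec (Subset n) k → Bool
ascentᵇ X Y j [] = X ⊆ᵇ Y
ascentᵇ X Y j (Z ∷ v) = (X ⊆ᵇ Z) ∧ ((∣ Z ∣ ≡ᵇ j) ∧ ascentᵇ Z Y (suc j) v)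

ascentViaᵇ : ∀ {k} → Subset n → List (Subset n) → Subset n → ℕ → Vec (Subset n) k → Bool
ascentViaᵇ X [] Y j v = ascentᵇ X Y j v
ascentViaᵇ X (W ∷ ws) Y j [] = false
ascentViaᵇ X (W ∷ ws) Y j (Z ∷ v) = (X ⊆ᵇ Z) ∧ ((∣ Z ∣ ≡ᵇ j) ∧
  (if Z ==ᵇ W then ascentViaᵇ Z ws Y (suc j) v else ascentViaᵇ Z (W ∷ ws) Y (suc j) v))

count-ascents : ∀ k (X Y : Subset n) →
  countSeqs n k (ascentᵇ X Y (suc ∣ X ∣)) ≡ (if X ⊆ᵇ Y then falling (∣ Y ∣ ∸ ∣ X ∣) k else 0)
count-ascents zero X Y with X ⊆ᵇ Y
... | true = refl
... | false = refl
count-ascents {n} (suc k) X Y = trans (countSeqs-suc n k _)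
  (trans (sum-map-guarded _ (betweenᵇ X (suc ∣ X ∣) Y) c first-step (allSubsets n)) (covers-times-c (X ⊆ᵇ Y) refl))
  where
  c : ℕ
  c = falling (∣ Y ∣ ∸ suc ∣ X ∣) k
  first-step : ∀ Z → countSeqs n k (ascentᵇ X Y (suc ∣ X ∣) ∘ (Z ∷_)) ≡ (if betweenᵇ X (suc ∣ X ∣) Y Z then c else 0)
  first-step Z with X ⊆ᵇ Z
  ... | false = countᵇ-false (λ _ → refl) (allVecs k (allSubsets n))
  ... | true with ∣ Z ∣ ≡ᵇ suc ∣ X ∣ in ∣Z∣≡
  ...   | false = countᵇ-false (λ _ → refl) (allVecs k (allSubsets n))
  ...   | true = subst (λ t → countSeqs n k (ascentᵇ Z Y (suc t)) ≡ (if Z ⊆ᵇ Y then falling (∣ Y ∣ ∸ t) k else 0))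
                   (≡ᵇ-true⇒≡ ∣Z∣≡) (count-ascents k Z Y)
  covers-times-c : ∀ b → (X ⊆ᵇ Y) ≡ b →
    countᵇ (betweenᵇ X (suc ∣ X ∣) Y) (allSubsets n) * c ≡ (if b then falling (∣ Y ∣ ∸ ∣ X ∣) (suc k) else 0)
  covers-times-c b X⊆Y rewrite count-between-1+∣X∣ X Y | X⊆Y with b
  ... | false = refl
  ... | true = cong (λ t → (∣ Y ∣ ∸ ∣ X ∣) * falling t k) (sym (pred[m∸n]≡m∸[1+n] ∣ Y ∣ ∣ X ∣))

count-ascentsVia : ∀ (W : Subset n) ws Y k X → (X ==ᵇ W) ≡ false →
  countSeqs n k (ascentViaᵇ X (W ∷ ws) Y (suc ∣ X ∣)) ≡
  (if X ⊆ᵇ W then climbThen (λ r → countSeqs n r (ascentViaᵇ W ws Y (suc ∣ W ∣))) (∣ W ∣ ∸ ∣ X ∣) k else 0)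
count-ascentsVia W ws Y zero X X≠W with X ⊆ᵇ W in X⊆W
... | false = refl
... | true with ∣ W ∣ ∸ ∣ X ∣ | m<n⇒0<n∸m (⊂ᵇ⇒∣∣< X W X⊆W X≠W)
...   | suc g | _ = refl
count-ascentsVia {n} W ws Y (suc k) X X≠W = trans (countSeqs-suc n k _)
  (trans (sum-map-guarded _ (betweenᵇ X (suc ∣ X ∣) W) c first-step (allSubsets n)) covers-times-c)
  where
  rest : ℕ → ℕ
  rest r = countSeqs n r (ascentViaᵇ W ws Y (suc ∣ W ∣))
  c : ℕ
  c = climbThen rest (∣ W ∣ ∸ suc ∣ X ∣) k
  first-step : ∀ Z → countSeqs n k (ascentViaᵇ X (W ∷ ws) Y (suc ∣ X ∣) ∘ (Z ∷_)) ≡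
                     (if betweenᵇ X (suc ∣ X ∣) W Z then c else 0)
  first-step Z with X ⊆ᵇ Z
  ... | false = countᵇ-false (λ _ → refl) (allVecs k (allSubsets n))
  ... | true with ∣ Z ∣ ≡ᵇ suc ∣ X ∣ in ∣Z∣≡
  ...   | false = countᵇ-false (λ _ → refl) (allVecs k (allSubsets n))
  ...   | true with ≡ᵇ-true⇒≡ ∣Z∣≡ | Z ==ᵇ W in Z=W
  ...     | ∣Z∣≡1+∣X∣ | false = subst
            (λ t → countSeqs n k (ascentViaᵇ Z (W ∷ ws) Y (suc t)) ≡
                   (if Z ⊆ᵇ W then climbThen rest (∣ W ∣ ∸ t) k else 0))
            ∣Z∣≡1+∣X∣ (count-ascentsVia W ws Y k Z Z=W)
  ...     | ∣Z∣≡1+∣X∣ | true with ==ᵇ⇒≡ Z W Z=W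
  ...       | refl rewrite ⊆ᵇ-refl Z | sym ∣Z∣≡1+∣X∣ | n∸n≡0 ∣ Z ∣ = refl
  covers-times-c : countᵇ (betweenᵇ X (suc ∣ X ∣) W) (allSubsets n) * c ≡
                   (if X ⊆ᵇ W then climbThen rest (∣ W ∣ ∸ ∣ X ∣) (suc k) else 0)
  covers-times-c rewrite count-between-1+∣X∣ X W with X ⊆ᵇ W in X⊆W
  ... | false = refl
  ... | true with m<n⇒0<n∸m (⊂ᵇ⇒∣∣< X W X⊆W X≠W) | pred[m∸n]≡m∸[1+n] ∣ W ∣ ∣ X ∣
  ...   | _ | pred≡ with ∣ W ∣ ∸ ∣ X ∣
  ...     | suc g rewrite sym pred≡ = refl

-- Full chains through one or two sets

_∈ᵇ_ : ∀ {k} → Subset n → Vec (Subset n) k → Bool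
S ∈ᵇ v = any (S ==ᵇ_) (toList v)

sizesFrom∧nested≡ascentᵇ : ∀ {k} (X : Subset n) j (v : Vec (Subset n) k) →
                           (sizesFrom j v ∧ nested (X ∷ v)) ≡ ascentᵇ X ⊤ j v
sizesFrom∧nested≡ascentᵇ X j [] = sym (⊆ᵇ⊤ X)
sizesFrom∧nested≡ascentᵇ X j (Z ∷ v) =
  trans (shuffle (∣ Z ∣ ≡ᵇ j) (sizesFrom (suc j) v) (X ⊆ᵇ Z) (nested (Z ∷ v)))
    (cong (λ t → (X ⊆ᵇ Z) ∧ ((∣ Z ∣ ≡ᵇ j) ∧ t)) (sizesFrom∧nested≡ascentᵇ Z (suc j) v))
  where
  shuffle : ∀ a b c d → ((a ∧ b) ∧ (c ∧ d)) ≡ (c ∧ (a ∧ (b ∧ d)))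
  shuffle a b true d = ∧-assoc a b d
  shuffle a b false d = ∧-zeroʳ (a ∧ b)

isFullChainᵇ-∷ : ∀ (C₀ : Subset n) v → isFullChainᵇ (C₀ ∷ v) ≡ ((C₀ ==ᵇ ⊥) ∧ ascentᵇ C₀ ⊤ 1 v)
isFullChainᵇ-∷ C₀ v = trans (∧-assoc (∣ C₀ ∣ ≡ᵇ 0) (sizesFrom 1 v) (nested (C₀ ∷ v)))
  (cong₂ _∧_ (∣∣≡ᵇ0≡==ᵇ⊥ C₀) (sizesFrom∧nested≡ascentᵇ C₀ 1 v))

ascentᵇ∧∈ᵇ≡ascentViaᵇ : ∀ {k} (S X Y : Subset n) j (v : Vec (Subset n) k) →
                        (ascentᵇ X Y j v ∧ (S ∈ᵇ v)) ≡ ascentViaᵇ X [ S ] Y j v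
ascentᵇ∧∈ᵇ≡ascentViaᵇ S X Y j [] = ∧-zeroʳ _
ascentᵇ∧∈ᵇ≡ascentViaᵇ S X Y j (Z ∷ v) rewrite ==ᵇ-sym S Z with Z ==ᵇ S
... | true = ∧-identityʳ _
... | false = trans (∧-assoc (X ⊆ᵇ Z) _ (S ∈ᵇ v))
  (cong ((X ⊆ᵇ Z) ∧_) (trans (∧-assoc (∣ Z ∣ ≡ᵇ j) _ (S ∈ᵇ v))
    (cong ((∣ Z ∣ ≡ᵇ j) ∧_) (ascentᵇ∧∈ᵇ≡ascentViaᵇ S Z Y (suc j) v))))

ascentᵇ∧∈ᵇ⇒≤∣∣ : ∀ {k} (S X Y : Subset n) j (v : Vec (Subset n) k) →
                 ascentᵇ X Y j v ≡ true → (S ∈ᵇ v) ≡ true → j ≤ ∣ S ∣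
ascentᵇ∧∈ᵇ⇒≤∣∣ S X Y j (Z ∷ v) asc S∈v with ∧≡true⇒ (X ⊆ᵇ Z) _ asc
... | _ , asc′ with ∧≡true⇒ (∣ Z ∣ ≡ᵇ j) (ascentᵇ Z Y (suc j) v) asc′
...   | ∣Z∣≡j , asc″ with S ==ᵇ Z in S=Z
...     | true = ≤-reflexive (trans (sym (≡ᵇ-true⇒≡ ∣Z∣≡j)) (sym (cong ∣_∣ (==ᵇ⇒≡ S Z S=Z))))
...     | false = ≤-trans (n≤1+n j) (ascentᵇ∧∈ᵇ⇒≤∣∣ S Z Y (suc j) v asc″ S∈v)

ascentᵇ∧∈ᵇ∧∈ᵇ⇒ascentViaᵇ : ∀ {k} (S T X Y : Subset n) j (v : Vec (Subset n) k) →
  ∣ S ∣ ≤ ∣ T ∣ → (S ==ᵇ T) ≡ false → ascentᵇ X Y j v ≡ true → (S ∈ᵇ v) ≡ true → (T ∈ᵇ v) ≡ true →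
  ascentViaᵇ X (S ∷ T ∷ []) Y j v ≡ true
ascentᵇ∧∈ᵇ∧∈ᵇ⇒ascentViaᵇ S T X Y j (Z ∷ v) ∣S∣≤∣T∣ S≠T asc S∈ T∈ with ∧≡true⇒ (X ⊆ᵇ Z) _ asc
... | X⊆Z , asc′ with ∧≡true⇒ (∣ Z ∣ ≡ᵇ j) (ascentᵇ Z Y (suc j) v) asc′
...   | ∣Z∣≡j , asc″ rewrite X⊆Z | ∣Z∣≡j | ==ᵇ-sym Z S with S ==ᵇ Z in S=Z | T ==ᵇ Z in T=Z
...     | true | true = contradiction (trans (sym S≠T) (subst (λ U → (S ==ᵇ U) ≡ true)
                          (trans (==ᵇ⇒≡ S Z S=Z) (sym (==ᵇ⇒≡ T Z T=Z))) (==ᵇ-refl S))) λ ()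
...     | true | false = trans (sym (ascentᵇ∧∈ᵇ≡ascentViaᵇ T Z Y (suc j) v))
                           (trans (cong (ascentᵇ Z Y (suc j) v ∧_) T∈) (trans (∧-identityʳ _) asc″))
...     | false | true = contradiction
                           (≤-trans (ascentᵇ∧∈ᵇ⇒≤∣∣ S Z Y (suc j) v asc″ S∈)
                             (≤-trans ∣S∣≤∣T∣ (≤-reflexive (trans (cong ∣_∣ (==ᵇ⇒≡ T Z T=Z)) (≡ᵇ-true⇒≡ ∣Z∣≡j)))))
                           (<⇒≱ (n<1+n j))
...     | false | false = ascentᵇ∧∈ᵇ∧∈ᵇ⇒ascentViaᵇ S T Z Y (suc j) v ∣S∣≤∣T∣ S≠T asc″ S∈ T∈

countᵇ-fullChains : ∀ (P : Vec (Subset n) (suc n) → Bool) →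
  countᵇ P (fullChains n) ≡ countSeqs n n (λ v → ascentᵇ ⊥ ⊤ 1 v ∧ P (⊥ ∷ v))
countᵇ-fullChains {n} P = begin
  countᵇ P (fullChains n)
    ≡⟨ countᵇ-filterᵇ isFullChainᵇ P (allVecs (suc n) (allSubsets n)) ⟩
  countSeqs n (suc n) (λ c → isFullChainᵇ c ∧ P c)
    ≡⟨ countSeqs-suc n n _ ⟩
  sum (map (λ Z → countSeqs n n (λ v → isFullChainᵇ (Z ∷ v) ∧ P (Z ∷ v))) (allSubsets n))
    ≡⟨ sum-map-guarded _ (_==ᵇ ⊥) K from⊥ (allSubsets n) ⟩
  countᵇ (_==ᵇ ⊥) (allSubsets n) * K
    ≡⟨ cong (_* K) (countᵇ-==ᵇ (⊥ {n})) ⟩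
  1 * K
    ≡⟨ *-identityˡ K ⟩
  K ∎
  where
  open ≡-Reasoning
  K : ℕ
  K = countSeqs n n (λ v → ascentᵇ ⊥ ⊤ 1 v ∧ P (⊥ ∷ v))
  from⊥ : ∀ Z → countSeqs n n (λ v → isFullChainᵇ (Z ∷ v) ∧ P (Z ∷ v)) ≡ (if Z ==ᵇ ⊥ then K else 0)
  from⊥ Z = trans (countSeqs-cong n n (λ v → cong (_∧ P (Z ∷ v)) (isFullChainᵇ-∷ Z v))) (case (Z ==ᵇ ⊥) refl)
    where
    case : ∀ b → (Z ==ᵇ ⊥) ≡ b →
           countSeqs n n (λ v → ((Z ==ᵇ ⊥) ∧ ascentᵇ Z ⊤ 1 v) ∧ P (Z ∷ v)) ≡ (if b then K else 0)
    case false Z≠⊥ rewrite Z≠⊥ = countᵇ-false (λ _ → refl) (allVecs n (allSubsets n))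
    case true Z=⊥ rewrite ==ᵇ⇒≡ Z ⊥ Z=⊥ | ==ᵇ-refl (⊥ {n}) = refl

ascents-to-⊤ : ∀ (S : Subset n) r → countSeqs n r (ascentᵇ S ⊤ (suc ∣ S ∣)) ≡ falling (n ∸ ∣ S ∣) r
ascents-to-⊤ {n} S r = begin
  countSeqs n r (ascentᵇ S ⊤ (suc ∣ S ∣))
    ≡⟨ count-ascents r S ⊤ ⟩
  (if S ⊆ᵇ ⊤ then falling (∣ ⊤ {n} ∣ ∸ ∣ S ∣) r else 0)
    ≡⟨ cong (λ b → if b then falling (∣ ⊤ {n} ∣ ∸ ∣ S ∣) r else 0) (⊆ᵇ⊤ S) ⟩
  falling (∣ ⊤ {n} ∣ ∸ ∣ S ∣) r
    ≡⟨ cong (λ t → falling (t ∸ ∣ S ∣) r) (∣⊤∣≡n n) ⟩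
  falling (n ∸ ∣ S ∣) r ∎
  where open ≡-Reasoning

ascentsVia-from-⊥ : ∀ (S : Subset n) ws → (S ==ᵇ ⊥) ≡ false →
  countSeqs n n (ascentViaᵇ ⊥ (S ∷ ws) ⊤ 1) ≡ climbThen (λ r → countSeqs n r (ascentViaᵇ S ws ⊤ (suc ∣ S ∣))) ∣ S ∣ n
ascentsVia-from-⊥ {n} S ws S≠⊥ = begin
  countSeqs n n (ascentViaᵇ ⊥ (S ∷ ws) ⊤ 1)
    ≡⟨ cong (λ t → countSeqs n n (ascentViaᵇ ⊥ (S ∷ ws) ⊤ (suc t))) (sym (∣⊥∣≡0 n)) ⟩
  countSeqs n n (ascentViaᵇ ⊥ (S ∷ ws) ⊤ (suc ∣ ⊥ {n} ∣))
    ≡⟨ count-ascentsVia S ws ⊤ n ⊥ (trans (==ᵇ-sym ⊥ S) S≠⊥) ⟩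
  (if ⊥ ⊆ᵇ S then climbThen rest (∣ S ∣ ∸ ∣ ⊥ {n} ∣) n else 0)
    ≡⟨ cong (λ b → if b then climbThen rest (∣ S ∣ ∸ ∣ ⊥ {n} ∣) n else 0) (⊥⊆ᵇ S) ⟩
  climbThen rest (∣ S ∣ ∸ ∣ ⊥ {n} ∣) n
    ≡⟨ cong (λ t → climbThen rest (∣ S ∣ ∸ t) n) (∣⊥∣≡0 n) ⟩
  climbThen rest ∣ S ∣ n
    ∎
  where
  open ≡-Reasoning
  rest : ℕ → ℕ
  rest r = countSeqs n r (ascentViaᵇ S ws ⊤ (suc ∣ S ∣))

chainsThrough : ∀ (S : Subset n) → countᵇ (S ∈ᵇ_) (fullChains n) ≡ ∣ S ∣ ! * (n ∸ ∣ S ∣) !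
chainsThrough {n} S with S ==ᵇ ⊥ in S=⊥
... | true rewrite ==ᵇ⇒≡ S ⊥ S=⊥ = begin
  countᵇ (⊥ ∈ᵇ_) (fullChains n)                      ≡⟨ countᵇ-fullChains {n} (⊥ ∈ᵇ_) ⟩
  countSeqs n n (λ v → ascentᵇ ⊥ ⊤ 1 v ∧ (⊥ ∈ᵇ (⊥ ∷ v)))
      ≡⟨ countSeqs-cong n n (λ v → cong (λ b → ascentᵇ ⊥ ⊤ 1 v ∧ (b ∨ (⊥ ∈ᵇ v))) (==ᵇ-refl (⊥ {n}))) ⟩
  countSeqs n n (λ v → ascentᵇ ⊥ ⊤ 1 v ∧ true)       ≡⟨ countSeqs-cong n n (λ v → ∧-identityʳ _) ⟩
  countSeqs n n (ascentᵇ ⊥ ⊤ 1)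
      ≡⟨ cong (λ t → countSeqs n n (ascentᵇ ⊥ ⊤ (suc t))) (sym (∣⊥∣≡0 n)) ⟩
  countSeqs n n (ascentᵇ ⊥ ⊤ (suc ∣ ⊥ {n} ∣))        ≡⟨ ascents-to-⊤ ⊥ n ⟩
  falling (n ∸ ∣ ⊥ {n} ∣) n                          ≡⟨ cong (λ t → falling (n ∸ t) n) (∣⊥∣≡0 n) ⟩
  falling n n                                        ≡⟨ falling-n-n≡n! n ⟩
  n !                                                ≡⟨ sym (+-identityʳ (n !)) ⟩
  0 ! * (n ∸ 0) !                                    ≡⟨ cong (λ t → t ! * (n ∸ t) !) (sym (∣⊥∣≡0 n)) ⟩
  ∣ ⊥ {n} ∣ ! * (n ∸ ∣ ⊥ {n} ∣) !                    ∎
  where open ≡-Reasoning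
... | false = begin
  countᵇ (S ∈ᵇ_) (fullChains n)                      ≡⟨ countᵇ-fullChains {n} (S ∈ᵇ_) ⟩
  countSeqs n n (λ v → ascentᵇ ⊥ ⊤ 1 v ∧ (S ∈ᵇ (⊥ ∷ v)))
      ≡⟨ countSeqs-cong n n (λ v → cong (λ b → ascentᵇ ⊥ ⊤ 1 v ∧ (b ∨ (S ∈ᵇ v))) S=⊥) ⟩
  countSeqs n n (λ v → ascentᵇ ⊥ ⊤ 1 v ∧ (S ∈ᵇ v))    ≡⟨ countSeqs-cong n n (ascentᵇ∧∈ᵇ≡ascentViaᵇ S ⊥ ⊤ 1) ⟩
  countSeqs n n (ascentViaᵇ ⊥ [ S ] ⊤ 1)             ≡⟨ ascentsVia-from-⊥ S [] S=⊥ ⟩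
  climbThen toTop s n                      ≡⟨ cong (climbThen toTop s) (sym (m+[n∸m]≡n (∣p∣≤n S))) ⟩
  climbThen toTop s (s + (n ∸ s))          ≡⟨ climbThen-+ toTop s (n ∸ s) ⟩
  s ! * toTop (n ∸ s)                      ≡⟨ cong (s ! *_) (ascents-to-⊤ S (n ∸ s)) ⟩
  s ! * falling (n ∸ s) (n ∸ s)            ≡⟨ cong (s ! *_) (falling-n-n≡n! (n ∸ s)) ⟩
  s ! * (n ∸ s) !                          ∎
  where
  open ≡-Reasoning
  s : ℕ
  s = ∣ S ∣
  toTop : ℕ → ℕ
  toTop r = countSeqs n r (ascentᵇ S ⊤ (suc ∣ S ∣))

chainsThroughBoth-≤ : ∀ (S T : Subset n) → 0 < ∣ S ∣ → ∣ S ∣ ≤ ∣ T ∣ → (S ==ᵇ T) ≡ false →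
  countᵇ (λ c → (S ∈ᵇ c) ∧ (T ∈ᵇ c)) (fullChains n) ≤
  ∣ S ∣ ! * (if S ⊆ᵇ T then (∣ T ∣ ∸ ∣ S ∣) ! * (n ∸ ∣ T ∣) ! else 0)
chainsThroughBoth-≤ {n} S T 0<∣S∣ ∣S∣≤∣T∣ S≠T = begin
  countᵇ (λ c → (S ∈ᵇ c) ∧ (T ∈ᵇ c)) (fullChains n)
    ≡⟨ countᵇ-fullChains {n} (λ c → (S ∈ᵇ c) ∧ (T ∈ᵇ c)) ⟩
  countSeqs n n (λ v → ascentᵇ ⊥ ⊤ 1 v ∧ ((S ∈ᵇ (⊥ ∷ v)) ∧ (T ∈ᵇ (⊥ ∷ v))))
    ≤⟨ countᵇ-mono meets-both (allVecs n (allSubsets n)) ⟩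
  countSeqs n n (ascentViaᵇ ⊥ (S ∷ T ∷ []) ⊤ 1)
    ≡⟨ ascentsVia-from-⊥ S [ T ] S≠⊥ ⟩
  climbThen (λ r → countSeqs n r (ascentViaᵇ S [ T ] ⊤ (suc ∣ S ∣))) ∣ S ∣ n
    ≤⟨ climbThen-≤ _ B S-to-⊤-via-T ∣ S ∣ n ⟩
  ∣ S ∣ ! * B
    ∎
  where
  open ≤-Reasoning
  B : ℕ
  B = if S ⊆ᵇ T then (∣ T ∣ ∸ ∣ S ∣) ! * (n ∸ ∣ T ∣) ! else 0
  S≠⊥ : (S ==ᵇ ⊥) ≡ false
  S≠⊥ = ∣∣>0⇒≠ᵇ⊥ S 0<∣S∣
  T≠⊥ : (T ==ᵇ ⊥) ≡ false
  T≠⊥ = ∣∣>0⇒≠ᵇ⊥ T (<-≤-trans 0<∣S∣ ∣S∣≤∣T∣)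
  meets-both : ∀ v → (ascentᵇ ⊥ ⊤ 1 v ∧ ((S ∈ᵇ (⊥ ∷ v)) ∧ (T ∈ᵇ (⊥ ∷ v)))) ≡ true →
               ascentViaᵇ ⊥ (S ∷ T ∷ []) ⊤ 1 v ≡ true
  meets-both v h rewrite S≠⊥ | T≠⊥ with ∧≡true⇒ (ascentᵇ ⊥ ⊤ 1 v) _ h
  ... | asc , h′ with ∧≡true⇒ (S ∈ᵇ v) _ h′
  ...   | S∈v , T∈v = ascentᵇ∧∈ᵇ∧∈ᵇ⇒ascentViaᵇ S T ⊥ ⊤ 1 v ∣S∣≤∣T∣ S≠T asc S∈v T∈v
  S-to-⊤-via-T : ∀ r → countSeqs n r (ascentViaᵇ S [ T ] ⊤ (suc ∣ S ∣)) ≤ B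
  S-to-⊤-via-T r = subst (_≤ B) (sym (count-ascentsVia T [] ⊤ r S S≠T)) (bound (S ⊆ᵇ T))
    where
    bound : ∀ b → (if b then climbThen (λ r → countSeqs n r (ascentᵇ T ⊤ (suc ∣ T ∣))) (∣ T ∣ ∸ ∣ S ∣) r else 0) ≤
                  (if b then (∣ T ∣ ∸ ∣ S ∣) ! * (n ∸ ∣ T ∣) ! else 0)
    bound false = z≤n
    bound true = climbThen-≤ _ _ (λ r → subst (_≤ (n ∸ ∣ T ∣) !) (sym (ascents-to-⊤ T r)) (falling≤! (n ∸ ∣ T ∣) r))
                   (∣ T ∣ ∸ ∣ S ∣) r

-- Union bound and Bonferroni inequality

module _ {A B : Set} (p : B → A → Bool) (L : List A) where

  anyᵇ : List B → A → Bool
  anyᵇ F x = any (λ b → p b x) F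

  pairCounts : List B → ℕ
  pairCounts [] = 0
  pairCounts (b ∷ F) = sum (map (λ b′ → countᵇ (λ x → p b x ∧ p b′ x) L) F) + pairCounts F

  countᵇ-∧-any-≤ : ∀ (q : A → Bool) F →
    countᵇ (λ x → q x ∧ anyᵇ F x) L ≤ sum (map (λ b → countᵇ (λ x → q x ∧ p b x) L) F)
  countᵇ-∧-any-≤ q [] = ≤-reflexive (countᵇ-false (λ x → ∧-zeroʳ (q x)) L)
  countᵇ-∧-any-≤ q (b ∷ F) = begin
    countᵇ (λ x → q x ∧ (p b x ∨ anyᵇ F x)) L
      ≡⟨ countᵇ-cong (λ x → ∧-distribˡ-∨ (q x) (p b x) (anyᵇ F x)) L ⟩
    countᵇ (λ x → (q x ∧ p b x) ∨ (q x ∧ anyᵇ F x)) L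
      ≤⟨ countᵇ-∨ _ _ L ⟩
    countᵇ (λ x → q x ∧ p b x) L + countᵇ (λ x → q x ∧ anyᵇ F x) L
      ≤⟨ +-monoʳ-≤ _ (countᵇ-∧-any-≤ q F) ⟩
    countᵇ (λ x → q x ∧ p b x) L + sum (map (λ b → countᵇ (λ x → q x ∧ p b x) L) F)
      ∎
    where open ≤-Reasoning

  union-bound : ∀ F → countᵇ (anyᵇ F) L ≤ sum (map (λ b → countᵇ (p b) L) F)
  union-bound = countᵇ-∧-any-≤ (λ _ → true)

  bonferroni : ∀ F → sum (map (λ b → countᵇ (p b) L) F) ≤ countᵇ (anyᵇ F) L + pairCounts F
  bonferroni [] = z≤n
  bonferroni (b ∷ F) = begin
    #b + sum (map (λ b → countᵇ (p b) L) F)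
      ≤⟨ +-monoʳ-≤ #b (bonferroni F) ⟩
    #b + (countᵇ (anyᵇ F) L + pairCounts F)
      ≡⟨ +-assoc #b _ _ ⟨
    (#b + countᵇ (anyᵇ F) L) + pairCounts F
      ≡⟨ cong (_+ pairCounts F) (countᵇ-∨+countᵇ-∧ (p b) (anyᵇ F) L) ⟨
    (countᵇ (anyᵇ (b ∷ F)) L + countᵇ (λ x → p b x ∧ anyᵇ F x) L) + pairCounts F
      ≤⟨ +-monoˡ-≤ (pairCounts F) (+-monoʳ-≤ (countᵇ (anyᵇ (b ∷ F)) L) (countᵇ-∧-any-≤ (p b) F)) ⟩
    (countᵇ (anyᵇ (b ∷ F)) L + sum (map (λ b′ → countᵇ (λ x → p b x ∧ p b′ x) L) F)) + pairCounts F
      ≡⟨ +-assoc (countᵇ (anyᵇ (b ∷ F)) L) _ _ ⟩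
    countᵇ (anyᵇ (b ∷ F)) L + pairCounts (b ∷ F)
      ∎
    where
    open ≤-Reasoning
    #b : ℕ
    #b = countᵇ (p b) L

  member-≤-any : ∀ {b F} → b ∈ F → countᵇ (p b) L ≤ countᵇ (anyᵇ F) L
  member-≤-any b∈F = countᵇ-mono (λ x → any-true x b∈F) L
    where
    any-true : ∀ {b F} x → b ∈ F → p b x ≡ true → anyᵇ F x ≡ true
    any-true x (here refl) pbx rewrite pbx = refl
    any-true {F = c ∷ F} x (there b∈F) pbx rewrite any-true x b∈F pbx = ∨-zeroʳ (p c x)

-- Families of sets and the interval family

foldr-⊓-≤ : ∀ x xs {y} → y ∈ x ∷ xs → foldr _⊓_ x xs ≤ y
foldr-⊓-≤ x [] (here refl) = ≤-refl
foldr-⊓-≤ x (z ∷ xs) (here refl) = ≤-trans (m⊓n≤n z _) (foldr-⊓-≤ x xs (here refl))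
foldr-⊓-≤ x (z ∷ xs) (there (here refl)) = m⊓n≤m z _
foldr-⊓-≤ x (z ∷ xs) (there (there y∈xs)) = ≤-trans (m⊓n≤n z _) (foldr-⊓-≤ x xs (there y∈xs))

minList-≤ : ∀ {xs y} → y ∈ xs → minList xs ≤ y
minList-≤ {x ∷ xs} = foldr-⊓-≤ x xs

minList-∈ : ∀ {xs y} → y ∈ xs → minList xs ∈ xs
minList-∈ {x ∷ xs} _ with foldr-selective ⊓-sel x xs
... | inj₁ min≡x = here min≡x
... | inj₂ min∈xs = there min∈xs

∈-allSubsets : ∀ (S : Subset n) → S ∈ allSubsets n
∈-allSubsets [] = here refl
∈-allSubsets {suc n} (true ∷ S) = ∈-++⁺ˡ (∈-map⁺ (true ∷_) (∈-allSubsets S))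
∈-allSubsets {suc n} (false ∷ S) = ∈-++⁺ʳ (map (true ∷_) (allSubsets n)) (∈-map⁺ (false ∷_) (∈-allSubsets S))

∈-allVecs : ∀ {k} (v : Vec (Subset n) k) → v ∈ allVecs k (allSubsets n)
∈-allVecs [] = here refl
∈-allVecs (S ∷ v) = ∈-concatMap⁺ (λ S → map (S ∷_) (allVecs _ (allSubsets _)))
  (lose (∈-allSubsets S) (∈-map⁺ (S ∷_) (∈-allVecs v)))

∈-families⁺ : ∀ {m} (v : Vec (Subset n) m) → distinctᵇ (toList v) ≡ true → toList v ∈ families m n
∈-families⁺ v distinct = ∈-filter⁺ (T? ∘ distinctᵇ) (∈-map⁺ toList (∈-allVecs v)) (Equivalence.from T-≡ distinct)

∈-families⁻ : ∀ {n m F} → F ∈ families m n → length F ≡ m × distinctᵇ F ≡ true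
∈-families⁻ {n} {m} F∈ with ∈-filter⁻ (T? ∘ distinctᵇ) {xs = map toList (allVecs m (allSubsets n))} F∈
... | F∈′ , distinct with ∈-map⁻ toList F∈′
...   | v , _ , F≡v = trans (cong length F≡v) (length-toList v) , Equivalence.to T-≡ distinct

interval : ∀ n → ℕ → ℕ → Subset n
interval zero i h = []
interval (suc n) zero zero = false ∷ interval n 0 0
interval (suc n) zero (suc h) = true ∷ interval n 0 h
interval (suc n) (suc i) h = false ∷ interval n i h

∣interval∣ : ∀ n i h → i + h ≤ n → ∣ interval n i h ∣ ≡ h
∣interval∣ zero zero zero _ = refl
∣interval∣ (suc n) zero zero _ = ∣interval∣ n 0 0 z≤n
∣interval∣ (suc n) zero (suc h) (s≤s h≤n) = cong suc (∣interval∣ n 0 h h≤n)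
∣interval∣ (suc n) (suc i) h (s≤s i+h≤n) = ∣interval∣ n i h i+h≤n

interval-≠ᵇ : ∀ n {i j h} → i < j → 0 < h → j + h ≤ n → (interval n i h ==ᵇ interval n j h) ≡ false
interval-≠ᵇ (suc n) {zero} {suc j} {suc h} _ _ _ = refl
interval-≠ᵇ (suc n) {suc i} {suc j} (s≤s i<j) 0<h (s≤s j+h≤n) = interval-≠ᵇ n i<j 0<h j+h≤n

intervals : ∀ n h s m → Vec (Subset n) m
intervals n h s zero = []
intervals n h s (suc m) = interval n s h ∷ intervals n h (suc s) m

private
  1+s+m+h≤ : ∀ {s m h n} → s + suc m + h ≤ suc n → suc s + m + h ≤ suc n
  1+s+m+h≤ {s} {m} {h} {n} = subst (_≤ suc n) (cong (_+ h) (+-suc s m))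

  s+h≤ : ∀ {s m h n} → s + suc m + h ≤ suc n → s + h ≤ n
  s+h≤ {s} {m} {h} le = ≤-trans (+-monoˡ-≤ h (m≤m+n s m)) (≤-pred (1+s+m+h≤ {s} le))

intervals-∉ : ∀ n {h i s} m → i < s → 0 < h → s + m + h ≤ suc n →
              all (λ Y → not (interval n i h ==ᵇ Y)) (toList (intervals n h s m)) ≡ true
intervals-∉ n zero _ _ _ = refl
intervals-∉ n {h} {i} {s} (suc m) i<s 0<h le rewrite interval-≠ᵇ n i<s 0<h (s+h≤ {s} le) =
  intervals-∉ n m (m≤n⇒m≤1+n i<s) 0<h (1+s+m+h≤ {s} le)

intervals-distinct : ∀ n {h s} m → 0 < h → s + m + h ≤ suc n → distinctᵇ (toList (intervals n h s m)) ≡ true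
intervals-distinct n zero _ _ = refl
intervals-distinct n {h} {s} (suc m) 0<h le rewrite intervals-∉ n m (n<1+n s) 0<h (1+s+m+h≤ {s} le) =
  intervals-distinct n m 0<h (1+s+m+h≤ {s} le)

∣intervals∣ : ∀ n {h s} m → s + m + h ≤ suc n → All (λ S → ∣ S ∣ ≡ h) (toList (intervals n h s m))
∣intervals∣ n zero _ = []
∣intervals∣ n {h} {s} (suc m) le = ∣interval∣ n s h (s+h≤ {s} le) ∷ ∣intervals∣ n m (1+s+m+h≤ {s} le)

-- The upper and lower bounds

chainsThrough*nC∣S∣≡n! : ∀ (S : Subset n) → countᵇ (S ∈ᵇ_) (fullChains n) * (n C ∣ S ∣) ≡ n !
chainsThrough*nC∣S∣≡n! {n} S = begin
  countᵇ (S ∈ᵇ_) (fullChains n) * (n C ∣ S ∣)   ≡⟨ cong (_* (n C ∣ S ∣)) (chainsThrough S) ⟩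
  ∣ S ∣ ! * (n ∸ ∣ S ∣) ! * (n C ∣ S ∣)         ≡⟨ *-comm _ (n C ∣ S ∣) ⟩
  (n C ∣ S ∣) * (∣ S ∣ ! * (n ∸ ∣ S ∣) !)       ≡⟨ nCk*k!*[n∸k]!≡n! (∣p∣≤n S) ⟩
  n !                                           ∎
  where open ≡-Reasoning

n!≤chainsThrough*nC⌊n/2⌋ : ∀ (S : Subset n) → n ! ≤ countᵇ (S ∈ᵇ_) (fullChains n) * (n C ⌊ n /2⌋)
n!≤chainsThrough*nC⌊n/2⌋ {n} S =
  subst (_≤ #S * (n C ⌊ n /2⌋)) (chainsThrough*nC∣S∣≡n! S) (*-monoʳ-≤ #S (nCk≤nC⌊n/2⌋ (∣p∣≤n S)))
  where
  #S : ℕ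
  #S = countᵇ (S ∈ᵇ_) (fullChains n)

sum-chainsThrough-level : ∀ {h} F → All (λ S → ∣ S ∣ ≡ h) F →
  sum (map (λ S → countᵇ (S ∈ᵇ_) (fullChains n)) F) ≡ length F * (h ! * (n ∸ h) !)
sum-chainsThrough-level [] [] = refl
sum-chainsThrough-level {n} {h} (S ∷ F) (∣S∣≡h ∷ ∣F∣≡h) = cong₂ _+_
  (trans (chainsThrough S) (cong (λ t → t ! * (n ∸ t) !) ∣S∣≡h)) (sum-chainsThrough-level F ∣F∣≡h)

intervals∈families : ∀ {m n} → 0 < ⌊ n /2⌋ → m + ⌊ n /2⌋ ≤ suc n → toList (intervals n ⌊ n /2⌋ 0 m) ∈ families m n
intervals∈families {m} {n} 0<h m+h≤1+n = ∈-families⁺ (intervals n ⌊ n /2⌋ 0 m) (intervals-distinct n m 0<h m+h≤1+n)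

abar-attained : ∀ {m n F₀} → F₀ ∈ families m n → ∃[ F ] F ∈ families m n × abar m n ≡ chainsHitting n F
abar-attained {m} {n} F₀∈ = ∈-map⁻ (chainsHitting n) (minList-∈ (∈-map⁺ (chainsHitting n) F₀∈))

abar*nC⌊n/2⌋≤m*n! : ∀ {m n} → 0 < ⌊ n /2⌋ → m + ⌊ n /2⌋ ≤ suc n → abar m n * (n C ⌊ n /2⌋) ≤ m * n !
abar*nC⌊n/2⌋≤m*n! {m} {n} 0<h m+h≤1+n = begin
  abar m n * Cₙ
    ≤⟨ *-monoˡ-≤ Cₙ (minList-≤ (∈-map⁺ (chainsHitting n) F₀∈)) ⟩
  chainsHitting n F₀ * Cₙ
    ≡⟨ cong (_* Cₙ) (length-filterᵇ (hitsᵇ F₀) (fullChains n)) ⟩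
  countᵇ (hitsᵇ F₀) (fullChains n) * Cₙ
    ≤⟨ *-monoˡ-≤ Cₙ (union-bound (λ S c → S ∈ᵇ c) (fullChains n) F₀) ⟩
  sum (map (λ S → countᵇ (S ∈ᵇ_) (fullChains n)) F₀) * Cₙ
    ≡⟨ cong (_* Cₙ) (sum-chainsThrough-level F₀ (∣intervals∣ n m m+h≤1+n)) ⟩
  length F₀ * (h ! * (n ∸ h) !) * Cₙ
    ≡⟨ cong (λ l → l * (h ! * (n ∸ h) !) * Cₙ) (length-toList (intervals n h 0 m)) ⟩
  m * (h ! * (n ∸ h) !) * Cₙ
    ≡⟨ regroup m (h ! * (n ∸ h) !) Cₙ ⟩
  m * (Cₙ * (h ! * (n ∸ h) !))
    ≡⟨ cong (m *_) (nCk*k!*[n∸k]!≡n! (⌊n/2⌋≤n n)) ⟩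
  m * n ! ∎
  where
  open ≤-Reasoning
  h : ℕ
  h = ⌊ n /2⌋
  Cₙ : ℕ
  Cₙ = n C h
  F₀ : List (Subset n)
  F₀ = toList (intervals n h 0 m)
  F₀∈ : F₀ ∈ families m n
  F₀∈ = intervals∈families 0<h m+h≤1+n
  regroup : ∀ a b c → a * b * c ≡ a * (c * b)
  regroup = solve-∀

smallLevel⇒m*n!≤chainsHitting*C : ∀ {m n} {S : Subset n} {F} → S ∈ F → m * (n C ∣ S ∣) ≤ n C ⌊ n /2⌋ →
  m * n ! ≤ chainsHitting n F * (n C ⌊ n /2⌋)
smallLevel⇒m*n!≤chainsHitting*C {m} {n} {S} {F} S∈F small = begin
  m * n !                                    ≡⟨ cong (m *_) (chainsThrough*nC∣S∣≡n! S) ⟨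
  m * (#S * (n C ∣ S ∣))                     ≡⟨ swap m #S (n C ∣ S ∣) ⟩
  #S * (m * (n C ∣ S ∣))                     ≤⟨ *-mono-≤ (member-≤-any (λ S c → S ∈ᵇ c) (fullChains n) S∈F) small ⟩
  countᵇ (hitsᵇ F) (fullChains n) * (n C ⌊ n /2⌋)
    ≡⟨ cong (_* (n C ⌊ n /2⌋)) (length-filterᵇ (hitsᵇ F) (fullChains n)) ⟨
  chainsHitting n F * (n C ⌊ n /2⌋)          ∎
  where
  open ≤-Reasoning
  #S : ℕ
  #S = countᵇ (S ∈ᵇ_) (fullChains n)
  swap : ∀ a b c → a * (b * c) ≡ b * (a * c)
  swap = solve-∀

BigLevel : ∀ {n} → ℕ → Subset n → Set
BigLevel {n} m S = n C ⌊ n /2⌋ < m * (n C ∣ S ∣)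

module _ {n m : ℕ} (m≤C : m ≤ n C ⌊ n /2⌋) where

  private
    m*nC0≤C : m * (n C 0) ≤ n C ⌊ n /2⌋
    m*nC0≤C = subst (_≤ n C ⌊ n /2⌋) (sym (*-identityʳ m)) m≤C

  BigLevel⇒0<∣S∣ : ∀ (S : Subset n) → BigLevel m S → 0 < ∣ S ∣
  BigLevel⇒0<∣S∣ S big = n≢0⇒n>0 λ ∣S∣≡0 →
    <⇒≱ big (subst (λ t → m * (n C t) ≤ n C ⌊ n /2⌋) (sym ∣S∣≡0) m*nC0≤C)

  BigLevel⇒∣S∣<n : ∀ (S : Subset n) → BigLevel m S → ∣ S ∣ < n
  BigLevel⇒∣S∣<n S big = ≤∧≢⇒< (∣p∣≤n S) λ ∣S∣≡n →
    <⇒≱ big (subst (λ t → m * (n C t) ≤ n C ⌊ n /2⌋) (sym ∣S∣≡n)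
      (subst (λ t → m * t ≤ n C ⌊ n /2⌋) (sym (nCn≡1 n)) m*nC0≤C))

  a!*[b∸a]!*[n∸b]!*C*[1+n]≤2m*n! : ∀ {a b} → 0 < a → a < b → b < n →
    n C ⌊ n /2⌋ < m * (n C a) → n C ⌊ n /2⌋ < m * (n C b) →
    a ! * ((b ∸ a) ! * (n ∸ b) !) * ((n C ⌊ n /2⌋) * suc n) ≤ 2 * m * n !
  a!*[b∸a]!*[n∸b]!*C*[1+n]≤2m*n! {a} {b} 0<a a<b b<n bigA bigB = begin
    a ! * ((b ∸ a) ! * (n ∸ b) !) * (Cₙ * suc n)     ≡⟨ regroup (a !) ((b ∸ a) !) ((n ∸ b) !) Cₙ (suc n) ⟩
    a ! * (b ∸ a) ! * (n ∸ b) ! * Cₙ * suc n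
      ≡⟨ cong (λ t → a ! * (b ∸ a) ! * (n ∸ b) ! * Cₙ * suc t) (sym a+q+r≡n) ⟩
    a ! * (b ∸ a) ! * (n ∸ b) ! * Cₙ * suc (a + (b ∸ a) + (n ∸ b))
      ≤⟨ p!q!r!c[1+p+q+r]≤2m[p+q+r]! {m = m} 0<a (m<n⇒0<n∸m a<b) (m<n⇒0<n∸m b<n) Cₙ≤m*binomB Cₙ≤m*binomA ⟩
    2 * m * (a + (b ∸ a) + (n ∸ b)) !               ≡⟨ cong (λ t → 2 * m * t !) a+q+r≡n ⟩
    2 * m * n !                                     ∎
    where
    open ≤-Reasoning
    Cₙ : ℕ
    Cₙ = n C ⌊ n /2⌋
    regroup : ∀ x y z c s → x * (y * z) * (c * s) ≡ x * y * z * c * s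
    regroup = solve-∀
    a+q≡b : a + (b ∸ a) ≡ b
    a+q≡b = m+[n∸m]≡n (<⇒≤ a<b)
    a+q+r≡n : a + (b ∸ a) + (n ∸ b) ≡ n
    a+q+r≡n = trans (cong (_+ (n ∸ b)) a+q≡b) (m+[n∸m]≡n (<⇒≤ b<n))
    q+r≡n∸a : (b ∸ a) + (n ∸ b) ≡ n ∸ a
    q+r≡n∸a = +-cancelˡ-≡ a _ _ (trans (sym (+-assoc a (b ∸ a) (n ∸ b)))
      (trans a+q+r≡n (sym (m+[n∸m]≡n (<⇒≤ (<-trans a<b b<n))))))
    Cₙ≤m*binomB : Cₙ ≤ m * binom (a + (b ∸ a)) (n ∸ b)
    Cₙ≤m*binomB = subst (λ t → Cₙ ≤ m * t)
      (trans (nCk≡binom (<⇒≤ b<n)) (cong (λ t → binom t (n ∸ b)) (sym a+q≡b))) (<⇒≤ bigB)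
    Cₙ≤m*binomA : Cₙ ≤ m * binom a ((b ∸ a) + (n ∸ b))
    Cₙ≤m*binomA = subst (λ t → Cₙ ≤ m * t)
      (trans (nCk≡binom (<⇒≤ (<-trans a<b b<n))) (cong (binom a) (sym q+r≡n∸a))) (<⇒≤ bigA)

  private
    orderedPair-bound : ∀ (S T : Subset n) → BigLevel m S → BigLevel m T → ∣ S ∣ ≤ ∣ T ∣ → (S ==ᵇ T) ≡ false →
      countᵇ (λ c → (S ∈ᵇ c) ∧ (T ∈ᵇ c)) (fullChains n) * ((n C ⌊ n /2⌋) * suc n) ≤ 2 * m * n !
    orderedPair-bound S T bigS bigT ∣S∣≤∣T∣ S≠T
      with S ⊆ᵇ T in S⊆T | chainsThroughBoth-≤ S T (BigLevel⇒0<∣S∣ S bigS) ∣S∣≤∣T∣ S≠T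
    ... | false | #≤0 = ≤-trans (*-monoˡ-≤ _ #≤0)
                          (subst (λ t → t * ((n C ⌊ n /2⌋) * suc n) ≤ 2 * m * n !) (sym (*-zeroʳ (∣ S ∣ !))) z≤n)
    ... | true | #≤ = ≤-trans (*-monoˡ-≤ _ #≤)
            (a!*[b∸a]!*[n∸b]!*C*[1+n]≤2m*n! (BigLevel⇒0<∣S∣ S bigS) (⊂ᵇ⇒∣∣< S T S⊆T S≠T)
              (BigLevel⇒∣S∣<n T bigT) bigS bigT)

  chainsThroughBoth*C*[1+n]≤2m*n! : ∀ (S T : Subset n) → BigLevel m S → BigLevel m T → (S ==ᵇ T) ≡ false →
    countᵇ (λ c → (S ∈ᵇ c) ∧ (T ∈ᵇ c)) (fullChains n) * ((n C ⌊ n /2⌋) * suc n) ≤ 2 * m * n !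
  chainsThroughBoth*C*[1+n]≤2m*n! S T bigS bigT S≠T with ≤-total ∣ S ∣ ∣ T ∣
  ... | inj₁ ∣S∣≤∣T∣ = orderedPair-bound S T bigS bigT ∣S∣≤∣T∣ S≠T
  ... | inj₂ ∣T∣≤∣S∣ = subst (λ t → t * ((n C ⌊ n /2⌋) * suc n) ≤ 2 * m * n !)
          (countᵇ-cong (λ c → ∧-comm (T ∈ᵇ c) (S ∈ᵇ c)) (fullChains n))
          (orderedPair-bound T S bigT bigS ∣T∣≤∣S∣ (trans (==ᵇ-sym T S) S≠T))

  pairCounts*C*[1+n]≤ : ∀ F → All (BigLevel m) F → distinctᵇ F ≡ true →
    pairCounts (λ S c → S ∈ᵇ c) (fullChains n) F * ((n C ⌊ n /2⌋) * suc n) ≤ length F * length F * (2 * m * n !)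
  pairCounts*C*[1+n]≤ [] _ _ = z≤n
  pairCounts*C*[1+n]≤ (S ∷ F) (bigS ∷ bigF) distinct with ∧≡true⇒ (all (λ T → not (S ==ᵇ T)) F) _ distinct
  ... | S∉F , distinctF = begin
    (row S F + pairCounts (λ S c → S ∈ᵇ c) (fullChains n) F) * X
      ≡⟨ *-distribʳ-+ X (row S F) _ ⟩
    row S F * X + pairCounts (λ S c → S ∈ᵇ c) (fullChains n) F * X
      ≤⟨ +-mono-≤ (row-bound S F bigS bigF S∉F) (pairCounts*C*[1+n]≤ F bigF distinctF) ⟩
    length F * B + length F * length F * B
      ≤⟨ m≤n+m _ (B + length F * B) ⟩
    (B + length F * B) + (length F * B + length F * length F * B)
      ≡⟨ square-suc (length F) B ⟩
    suc (length F) * suc (length F) * B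
      ∎
    where
    open ≤-Reasoning
    X : ℕ
    X = (n C ⌊ n /2⌋) * suc n
    B : ℕ
    B = 2 * m * n !
    row : Subset n → List (Subset n) → ℕ
    row S F = sum (map (λ T → countᵇ (λ c → (S ∈ᵇ c) ∧ (T ∈ᵇ c)) (fullChains n)) F)
    square-suc : ∀ a B → (B + a * B) + (a * B + a * a * B) ≡ (1 + a) * (1 + a) * B
    square-suc = solve-∀
    row-bound : ∀ S F → BigLevel m S → All (BigLevel m) F → all (λ T → not (S ==ᵇ T)) F ≡ true →
                row S F * X ≤ length F * B
    row-bound S [] _ _ _ = z≤n
    row-bound S (T ∷ F) bigS (bigT ∷ bigF) S∉ with ∧≡true⇒ (not (S ==ᵇ T)) _ S∉
    ... | S≠T , S∉F = begin
      (countᵇ (λ c → (S ∈ᵇ c) ∧ (T ∈ᵇ c)) (fullChains n) + row S F) * X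
        ≡⟨ *-distribʳ-+ X (countᵇ (λ c → (S ∈ᵇ c) ∧ (T ∈ᵇ c)) (fullChains n)) _ ⟩
      countᵇ (λ c → (S ∈ᵇ c) ∧ (T ∈ᵇ c)) (fullChains n) * X + row S F * X
        ≤⟨ +-mono-≤ (chainsThroughBoth*C*[1+n]≤2m*n! S T bigS bigT (Equivalence.to T-not-≡ (Equivalence.from T-≡ S≠T)))
                    (row-bound S F bigS bigF S∉F) ⟩
      B + length F * B
        ∎

  bigLevels⇒[m*n!∸chainsHitting*C]*[1+n]≤ : ∀ F → length F ≡ m → All (BigLevel m) F → distinctᵇ F ≡ true →
    (m * n ! ∸ chainsHitting n F * (n C ⌊ n /2⌋)) * suc n ≤ m * m * (2 * m * n !)
  bigLevels⇒[m*n!∸chainsHitting*C]*[1+n]≤ F ∣F∣≡m bigF distinct = begin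
    (m * n ! ∸ #F * Cₙ) * suc n     ≤⟨ *-monoˡ-≤ (suc n) (m≤n+o⇒m∸n≤o (m * n !) (#F * Cₙ) m*n!≤) ⟩
    pairs * Cₙ * suc n              ≡⟨ *-assoc pairs Cₙ (suc n) ⟩
    pairs * (Cₙ * suc n)            ≤⟨ pairCounts*C*[1+n]≤ F bigF distinct ⟩
    length F * length F * (2 * m * n !)  ≡⟨ cong (λ l → l * l * (2 * m * n !)) ∣F∣≡m ⟩
    m * m * (2 * m * n !)           ∎
    where
    open ≤-Reasoning
    Cₙ : ℕ
    Cₙ = n C ⌊ n /2⌋
    #F : ℕ
    #F = chainsHitting n F
    pairs : ℕ
    pairs = pairCounts (λ S c → S ∈ᵇ c) (fullChains n) F
    #_ : Subset n → ℕ
    # S = countᵇ (S ∈ᵇ_) (fullChains n)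
    l*n!≤sum*C : ∀ G → length G * n ! ≤ sum (map #_ G) * Cₙ
    l*n!≤sum*C [] = z≤n
    l*n!≤sum*C (S ∷ G) = subst (n ! + length G * n ! ≤_) (sym (*-distribʳ-+ Cₙ (# S) (sum (map #_ G))))
      (+-mono-≤ (n!≤chainsThrough*nC⌊n/2⌋ S) (l*n!≤sum*C G))
    m*n!≤ : m * n ! ≤ #F * Cₙ + pairs * Cₙ
    m*n!≤ = begin
      m * n !                          ≡⟨ cong (_* n !) ∣F∣≡m ⟨
      length F * n !                   ≤⟨ l*n!≤sum*C F ⟩
      sum (map #_ F) * Cₙ              ≤⟨ *-monoˡ-≤ Cₙ (bonferroni (λ S c → S ∈ᵇ c) (fullChains n) F) ⟩
      (countᵇ (hitsᵇ F) (fullChains n) + pairs) * Cₙ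
        ≡⟨ cong (λ t → (t + pairs) * Cₙ) (length-filterᵇ (hitsᵇ F) (fullChains n)) ⟨
      (#F + pairs) * Cₙ                ≡⟨ *-distribʳ-+ Cₙ #F pairs ⟩
      #F * Cₙ + pairs * Cₙ             ∎

  k*[m*n!∸chainsHitting*C]≤m*n! : ∀ {k F} → 2 * k * (m * m) ≤ suc n → F ∈ families m n →
    k * (m * n ! ∸ chainsHitting n F * (n C ⌊ n /2⌋)) ≤ m * n !
  k*[m*n!∸chainsHitting*C]≤m*n! {k} {F} 2km²≤1+n F∈ with ∈-families⁻ F∈
  ... | ∣F∣≡m , distinct with all? (λ S → n C ⌊ n /2⌋ <? m * (n C ∣ S ∣)) F
  ...   | no ¬bigF with find (¬All⇒Any¬ (λ S → n C ⌊ n /2⌋ <? m * (n C ∣ S ∣)) F ¬bigF)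
  ...     | S , S∈F , ¬bigS = subst (λ d → k * d ≤ m * n !)
            (sym (m≤n⇒m∸n≡0 (smallLevel⇒m*n!≤chainsHitting*C {m} S∈F (≮⇒≥ ¬bigS))))
            (subst (_≤ m * n !) (sym (*-zeroʳ k)) z≤n)
  k*[m*n!∸chainsHitting*C]≤m*n! {k} {F} 2km²≤1+n F∈ | ∣F∣≡m , distinct | yes bigF =
    *-cancelʳ-≤ (k * D) (m * n !) (suc n) (begin
      k * D * suc n                    ≡⟨ *-assoc k D (suc n) ⟩
      k * (D * suc n)                  ≤⟨ *-monoʳ-≤ k (bigLevels⇒[m*n!∸chainsHitting*C]*[1+n]≤ F ∣F∣≡m bigF distinct) ⟩
      k * (m * m * (2 * m * n !))      ≡⟨ regroup k m (n !) ⟩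
      2 * k * (m * m) * (m * n !)      ≤⟨ *-monoˡ-≤ (m * n !) 2km²≤1+n ⟩
      suc n * (m * n !)                ≡⟨ *-comm (suc n) (m * n !) ⟩
      m * n ! * suc n                  ∎)
    where
    open ≤-Reasoning
    D : ℕ
    D = m * n ! ∸ chainsHitting n F * (n C ⌊ n /2⌋)
    regroup : ∀ k m x → k * (m * m * (2 * m * x)) ≡ 2 * k * (m * m) * (m * x)
    regroup = solve-∀

m+m≤n⇒m+⌊n/2⌋≤n : ∀ {m n} → m + m ≤ n → m + ⌊ n /2⌋ ≤ n
m+m≤n⇒m+⌊n/2⌋≤n {m} {n} 2m≤n =
  subst (m + ⌊ n /2⌋ ≤_) (trans (+-comm ⌈ n /2⌉ ⌊ n /2⌋) (⌊n/2⌋+⌈n/2⌉≡n n)) (+-monoˡ-≤ ⌊ n /2⌋ m≤⌈n/2⌉)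
  where
  open ≤-Reasoning
  m≤⌈n/2⌉ : m ≤ ⌈ n /2⌉
  m≤⌈n/2⌉ = ≮⇒≥ λ ⌈n/2⌉<m → <⇒≱ (begin-strict
    n                      ≡⟨ ⌊n/2⌋+⌈n/2⌉≡n n ⟨
    ⌊ n /2⌋ + ⌈ n /2⌉      ≤⟨ +-monoˡ-≤ ⌈ n /2⌉ (⌊n/2⌋≤⌈n/2⌉ n) ⟩
    ⌈ n /2⌉ + ⌈ n /2⌉      <⟨ +-mono-< ⌈n/2⌉<m ⌈n/2⌉<m ⟩
    m + m                  ∎) 2m≤n

proposition1 : ∀ (m : ℕ) → 1 ≤ m → ∀ (k : ℕ) → 1 ≤ k → ∃[ N ] (∀ (n : ℕ) → N ≤ n → k * ∣ abar m n * (n C ⌊ n /2⌋) - m * (n !) ∣ ≤ m * (n !))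
proposition1 m 1≤m k _ = m + m + 2 * k * (m * m) , bound
  where
  bound : ∀ n → m + m + 2 * k * (m * m) ≤ n → k * ∣ abar m n * (n C ⌊ n /2⌋) - m * (n !) ∣ ≤ m * (n !)
  bound n N≤n = subst (λ d → k * d ≤ m * n !) (sym (m≤n⇒∣m-n∣≡n∸m upper))
    (lower (abar-attained {m} (intervals∈families {m} 0<⌊n/2⌋ m+⌊n/2⌋≤1+n)))
    where
    2m≤n : m + m ≤ n
    2m≤n = ≤-trans (m≤m+n (m + m) _) N≤n
    2≤n : 2 ≤ n
    2≤n = ≤-trans (+-mono-≤ 1≤m 1≤m) 2m≤n
    0<⌊n/2⌋ : 0 < ⌊ n /2⌋
    0<⌊n/2⌋ = ⌊n/2⌋-mono 2≤n
    m+⌊n/2⌋≤1+n : m + ⌊ n /2⌋ ≤ suc n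
    m+⌊n/2⌋≤1+n = m≤n⇒m≤1+n (m+m≤n⇒m+⌊n/2⌋≤n 2m≤n)
    m≤C : m ≤ n C ⌊ n /2⌋
    m≤C = ≤-trans (≤-trans (m≤m+n m m) 2m≤n) (n≤nC⌊n/2⌋ 2≤n)
    2km²≤1+n : 2 * k * (m * m) ≤ suc n
    2km²≤1+n = ≤-trans (m≤n+m _ (m + m)) (≤-trans N≤n (n≤1+n n))
    upper : abar m n * (n C ⌊ n /2⌋) ≤ m * n !
    upper = abar*nC⌊n/2⌋≤m*n! 0<⌊n/2⌋ m+⌊n/2⌋≤1+n
    lower : ∃[ F ] F ∈ families m n × abar m n ≡ chainsHitting n F → k * (m * n ! ∸ abar m n * (n C ⌊ n /2⌋)) ≤ m * n !
    lower (F , F∈ , abar≡) rewrite abar≡ = k*[m*n!∸chainsHitting*C]≤m*n! {m = m} m≤C {k} 2km²≤1+n F∈
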